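{- Let $(P,\rho)$ be a weakly ranked locally finite poset, $\kappa$ a $(P,\rho)$-kernel and $\mathrm{H}$ its Chow function. Then: (i) for every $s<t$ in $P$, $[x^{\rho_{st}-1}]\mathrm{H}_{st}(x)=[x^{\rho_{st}}]\kappa_{st}(x)$; in particular, if $\kappa$ is non-degenerate then $\deg\mathrm{H}_{st}(x)=\rho_{st}-1$ for every $s<t$; (ii) $\mathrm{H}_{st}(x)=x^{\rho_{st}-1}\mathrm{H}_{st}(x^{ -1})$ for every $s<t$ in $P$.
   Context: $P$ is a locally finite poset; $\operatorname{Int}(P)$ is its set of closed intervals. A weak rank function is a map $\rho:\operatorname{Int}(P)\to\mathbb{Z}_{\ge0}$, $[s,t]\mapsto\rho_{st}$, with $\rho_{st}>0$ whenever $s<t$ and $\rho_{st}=\rho_{sw}+\rho_{wt}$ for $s\le w\le t$. The incidence algebra $\mathcal{I}(P)$ consists of maps $a$ assigning to each $[s,t]$ a polynomial $a_{st}(x)\in\mathbb{Z}[x]$, with product $(ab)_{st}=\sum_{s\le w\le t}a_{sw}b_{wt}$. $\mathcal{I}_\rho(P)=\{a:\deg a_{st}\le\rho_{st}\}$, and $a^{\mathrm{rev}}_{st}(x)=x^{\rho_{st}}a_{st}(x^{ -1})$. A $(P,\rho)$-kernel is $\kappa\in\mathcal{I}_\rho(P)$ with $\kappa_{ss}=1$ for all $s$ and $\kappa^{ -1}=\kappa^{\mathrm{rev}}$; it is non-degenerate if $\deg\kappa_{st}=\rho_{st}$ for all $s\le t$. For $s<t$, $\kappa_{st}$ is divisible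 by $x-1$; the reduced kernel has $\overline{\kappa}_{st}=\kappa_{st}/(x-1)$ for $s<t$ and $\overline{\kappa}_{ss}=-1$. The Chow function is $\mathrm{H}=-(\overline{\kappa})^{ -1}\in\mathcal{I}(P)$. $[x^k]p$ denotes the coefficient of $x^k$ in $p$. -}

module Defs where

open import Level using (Level; suc; _⊔_)
open import Data.Nat as ℕ using (ℕ; zero; _∸_; _≤ᵇ_)
open import Data.Integer as ℤ using (ℤ; +_; -_; _+_; _*_)
open import Data.Bool using (if_then_else_)
open import Data.List using (List; []; _∷_; foldr; map; upTo)
open import Data.List.Membership.Propositional using (_∈_)
open import Data.List.Relation.Unary.Unique.Propositional using (Unique)
open import Data.Product using (_×_; Σ)
open import Relation.Binary.PropositionalEquality using (_≡_)
open import Relation.Binary.Structures using (IsPartialOrder)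
open import Relation.Nullary using (¬_)
open import Function.Bundles using (_⇔_)

record LFPoset (c ℓ : Level) : Set (Level.suc (c ⊔ ℓ)) where
  field
    Carrier        : Set c
    _≤_            : Carrier → Carrier → Set ℓ
    isPartialOrder : IsPartialOrder _≡_ _≤_
    interval       : Carrier → Carrier → List Carrier
    interval-unique : ∀ s t → Unique (interval s t)
    interval-spec  : ∀ s t w → (w ∈ interval s t) ⇔ (s ≤ w × w ≤ t)

  _<_ : Carrier → Carrier → Set (c ⊔ ℓ)
  s < t = s ≤ t × ¬ (s ≡ t)

-- Polynomials in ℤ[x], represented by their coefficient sequences
-- (coefficient of x^k at index k).  All elements we use have finite
-- support (guaranteed by the hypotheses), equality is coefficientwise.

Poly : Set
Poly = ℕ → ℤ

_≈ₚ_ : Poly → Poly → Set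
p ≈ₚ q = ∀ k → p k ≡ q k

sumℤ : List ℤ → ℤ
sumℤ = foldr _+_ (+ 0)

_*ₚ_ : Poly → Poly → Poly
(p *ₚ q) k = sumℤ (map (λ i → p i * q (k ∸ i)) (upTo (ℕ.suc k)))

constₚ : ℤ → Poly
constₚ a zero    = a
constₚ a (ℕ.suc _) = + 0

x-1 : Poly
x-1 zero = - (+ 1)
x-1 (ℕ.suc zero) = + 1
x-1 (ℕ.suc (ℕ.suc _)) = + 0

-- x^d p(x^{-1}) for a polynomial p of degree ≤ d (coefficients above d dropped)
revAt : ℕ → Poly → Poly
revAt d p k = if k ≤ᵇ d then p (d ∸ k) else + 0

DegLe : Poly → ℕ → Set
DegLe p d = ∀ k → d ℕ.< k → p k ≡ + 0

HasDegree : Poly → ℕ → Set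
HasDegree p d = ¬ (p d ≡ + 0) × DegLe p d

module _ {c ℓ : Level} (P : LFPoset c ℓ) where
  open LFPoset P

  -- weak rank function (only its values on intervals s ≤ t matter)
  record IsWeakRank (ρ : Carrier → Carrier → ℕ) : Set (c ⊔ ℓ) where
    field
      pos : ∀ s t → s < t → 0 ℕ.< ρ s t
      add : ∀ s w t → s ≤ w → w ≤ t → ρ s t ≡ ρ s w ℕ.+ ρ w t

  -- elements of the incidence algebra I(P): a_{st} for s ≤ t
  -- (values at pairs with s ≰ t are irrelevant junk)
  Inc : Set c
  Inc = Carrier → Carrier → Poly

  _⋆_ : Inc → Inc → Inc
  (a ⋆ b) s t k = sumℤ (map (λ w → (a s w *ₚ b w t) k) (interval s t))

  IsScalar : ℤ → Inc → Set (c ⊔ ℓ)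
  IsScalar e a = (∀ s → a s s ≈ₚ constₚ e) × (∀ s t → s < t → a s t ≈ₚ constₚ (+ 0))

  InIρ : (Carrier → Carrier → ℕ) → Inc → Set (c ⊔ ℓ)
  InIρ ρ a = ∀ s t → s ≤ t → DegLe (a s t) (ρ s t)

  rev : (Carrier → Carrier → ℕ) → Inc → Inc
  rev ρ a s t = revAt (ρ s t) (a s t)

  record IsKernel (ρ : Carrier → Carrier → ℕ) (κ : Inc) : Set (c ⊔ ℓ) where
    field
      inIρ    : InIρ ρ κ
      diag    : ∀ s → κ s s ≈ₚ constₚ (+ 1)
      inv-rev : IsScalar (+ 1) (κ ⋆ rev ρ κ)
      rev-inv : IsScalar (+ 1) (rev ρ κ ⋆ κ)

  NonDegenerate : (Carrier → Carrier → ℕ) → Inc → Set (c ⊔ ℓ)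
  NonDegenerate ρ κ = ∀ s t → s ≤ t → HasDegree (κ s t) (ρ s t)

  -- κ̄ is the reduced kernel of κ: κ̄_{ss} = -1, κ_{st} = (x-1) κ̄_{st} for s < t
  -- (the quotient by x-1 is unique, so this pins κ̄ down)
  IsReducedKernel : Inc → Inc → Set (c ⊔ ℓ)
  IsReducedKernel κ κ̄ =
    (∀ s → κ̄ s s ≈ₚ constₚ (- (+ 1))) ×
    (∀ s t → s < t → (x-1 *ₚ κ̄ s t) ≈ₚ κ s t)

  -- H is the Chow function: H = -(κ̄)^{-1}, i.e. κ̄ H = H κ̄ = -δ
  -- (inverses in the incidence algebra are unique, so this pins H down)
  IsChowFunction : Inc → Inc → Set (c ⊔ ℓ)
  IsChowFunction κ̄ H = IsScalar (- (+ 1)) (κ̄ ⋆ H) × IsScalar (- (+ 1)) (H ⋆ κ̄)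

{-# OPTIONS --safe #-}
module Submission where

-- Write κ = (x - 1) κ̄ + x δ. Evaluating κ^rev κ = δ at x = 1, where κ^rev and κ agree, shows that
-- κ(1) squares to δ in the ℤ-valued incidence algebra, so κ_st(1) = 0 for s < t; hence κ̄_st is a
-- polynomial of degree at most ρ_st - 1 (polynomials are coefficient sequences here, among which
-- x - 1 is invertible, so this needs an argument). From κ̄ H = -δ, induction on ρ_st bounds
-- deg H_st by ρ_st - 1, and H κ̄ = -δ says H κ = x H off the diagonal; comparing the coefficients
-- of x^ρ_st there gives (i). For (ii) put G_st = x^(ρ_st - 1) H_st(1/x). Reversing H κ = x H gives
-- G = H^rev κ^rev, so G κ = H^rev = x G off the diagonal, i.e. G κ̄ = -δ, and G = H because
-- inverses in the incidence algebra are unique.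

open import Defs hiding (_⋆_) renaming (_≈ₚ_ to infix 4 _≈ₚ_; _*ₚ_ to infixl 7 _*ₚ_)
open import Function using (_∘_)
open import Level using (Level; _⊔_)
open import Data.Bool using (true; false)
open import Data.Empty using (⊥; ⊥-elim)
open import Data.Nat as ℕ using (ℕ; zero; suc; _∸_; _≤ᵇ_; z≤n; s≤s)
import Data.Nat.Properties as ℕₚ
open import Data.Nat.Induction using (<-rec)
open import Data.Integer as ℤ using (ℤ; +_; -_; _+_; _*_; _-_)
import Data.Integer.Properties as ℤₚ
open import Data.Integer.Tactic.RingSolver using (solve-∀)
open import Data.List using (List; []; _∷_; _++_; map; applyUpTo)
open import Data.List.Properties using (map-upTo; map-cong-local; map-++; map-∘)
open import Data.List.Membership.Propositional using (_∈_)
open import Data.List.Membership.Propositional.Properties using (∈-∃++; ∈-map⁺; ∈-map⁻; ∈-++⁺ˡ; ∈-++⁺ʳ; ∈-++⁻)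
import Data.List.Relation.Unary.Unique.Propositional.Properties as Unique
open import Data.List.Membership.Propositional.Properties.WithK using (unique∧set⇒bag)
open import Data.List.Relation.Unary.All as All using (All)
import Data.List.Relation.Unary.AllPairs as AllPairs
open import Data.List.Relation.Unary.Any using (here; there)
open import Data.List.Relation.Unary.Unique.Propositional using (Unique)
open import Data.List.Relation.Binary.BagAndSetEquality using (_∼[_]_; set; ∼bag⇒↭)
open import Data.List.Relation.Binary.Permutation.Propositional using (_↭_; ↭-sym; ↭⇒↭ₛ)
open import Data.List.Relation.Binary.Permutation.Propositional.Properties
  using (shift; ∈-resp-↭) renaming (map⁺ to ↭-map⁺)
open import Data.List.Relation.Binary.Permutation.Setoid.Properties using (foldr-commMonoid; Unique-resp-↭)
open import Data.Product using (_×_; _,_; proj₁; proj₂; swap)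
open import Data.Sum using (inj₁; inj₂)
open import Relation.Binary.Bundles using (Setoid)
open import Relation.Binary.PropositionalEquality
  using (_≡_; _≢_; refl; sym; trans; cong; cong₂; subst; setoid; module ≡-Reasoning)
import Relation.Binary.Reasoning.Setoid as SetoidReasoning
open import Relation.Nullary using (Dec; yes; no)
open import Relation.Nullary.Decidable using (decidable-stable; ¬¬-excluded-middle; _→-dec_)
open import Relation.Binary.Structures using (IsPartialOrder)
open import Function.Bundles using (Equivalence; mk⇔)
open import Algebra.Properties.AbelianGroup ℤₚ.+-0-abelianGroup using () renaming (identityˡ-unique to +-identityˡ-unique)
open import Algebra.Properties.CommutativeSemigroup ℤₚ.+-commutativeSemigroup
  using (interchange) renaming (x∙yz≈y∙xz to +-left-comm)

suc-∸1 : ∀ {n} → 0 ℕ.< n → suc (n ∸ 1) ≡ n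
suc-∸1 {suc n} _ = refl

∸1+∸1≤∸1 : ∀ {m} n → 0 ℕ.< m → (m ∸ 1) ℕ.+ (n ∸ 1) ℕ.≤ (m ℕ.+ n) ∸ 1
∸1+∸1≤∸1 {suc m} n _ = ℕₚ.+-monoʳ-≤ m (ℕₚ.m∸n≤m n 1)

∸1+<+ : ∀ {m} n → 0 ℕ.< m → (m ∸ 1) ℕ.+ n ℕ.< m ℕ.+ n
∸1+<+ {suc m} n _ = ℕₚ.n<1+n (m ℕ.+ n)

-- Finite sums over duplicate-free lists

module _ {a} {A : Set a} where

  sum-map-cong : ∀ {f g : A → ℤ} xs → (∀ {y} → y ∈ xs → f y ≡ g y) → sumℤ (map f xs) ≡ sumℤ (map g xs)
  sum-map-cong xs f≗g = cong sumℤ (map-cong-local (All.tabulate f≗g))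

  sum-map-zero : ∀ {f : A → ℤ} xs → (∀ {y} → y ∈ xs → f y ≡ + 0) → sumℤ (map f xs) ≡ + 0
  sum-map-zero []       f≗0 = refl
  sum-map-zero (x ∷ xs) f≗0 = cong₂ _+_ (f≗0 (here refl)) (sum-map-zero xs (f≗0 ∘ there))

  sum-map-↭ : ∀ (f : A → ℤ) {xs ys} → xs ↭ ys → sumℤ (map f xs) ≡ sumℤ (map f ys)
  sum-map-↭ f p = foldr-commMonoid (setoid ℤ) ℤₚ.+-0-isCommutativeMonoid (↭⇒↭ₛ (↭-map⁺ f p))

  sum-map-set-equal : ∀ (f : A → ℤ) {xs ys} → Unique xs → Unique ys → xs ∼[ set ] ys →
                      sumℤ (map f xs) ≡ sumℤ (map f ys)
  sum-map-set-equal f xs! ys! xs∼ys = sum-map-↭ f (∼bag⇒↭ (unique∧set⇒bag xs! ys! xs∼ys))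

  record Removal (x : A) (xs : List A) : Set a where
    field
      rest        : List A
      rest-unique : Unique rest
      rest⊆       : ∀ {y} → y ∈ rest → y ∈ xs × y ≢ x
      ⊆rest       : ∀ {y} → y ∈ xs → y ≢ x → y ∈ rest
      sum-split   : ∀ f → sumℤ (map f xs) ≡ f x + sumℤ (map f rest)

  remove : ∀ {x xs} → Unique xs → x ∈ xs → Removal x xs
  remove {x} {xs} xs! x∈xs with ys , zs , refl ← ∈-∃++ x∈xs = record
    { rest        = ys ++ zs
    ; rest-unique = rest!
    ; rest⊆       = λ y∈ → ∈-resp-↭ (↭-sym xs↭) (there y∈) , λ { refl → All.lookup x∉rest y∈ refl }
    ; ⊆rest       = λ y∈ y≢x → drop-head (∈-resp-↭ xs↭ y∈) y≢x
    ; sum-split   = λ f → sum-map-↭ f xs↭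
    }
    where
    xs↭ = shift x ys zs
    x∷rest! : Unique (x ∷ ys ++ zs)
    x∷rest! = Unique-resp-↭ (setoid A) (↭⇒↭ₛ xs↭) xs!
    x∉rest = AllPairs.head x∷rest!
    rest!  = AllPairs.tail x∷rest!
    drop-head : ∀ {y} → y ∈ x ∷ ys ++ zs → y ≢ x → y ∈ ys ++ zs
    drop-head (here y≡x) y≢x = ⊥-elim (y≢x y≡x)
    drop-head (there y∈) _   = y∈

  sum-map-single : ∀ {x xs f} → Unique xs → x ∈ xs → (∀ {y} → y ∈ xs → y ≢ x → f y ≡ + 0) →
                   sumℤ (map f xs) ≡ f x
  sum-map-single {x} {xs} {f} xs! x∈xs f≗0 = trans (sum-split f)
    (trans (cong (_+_ (f x)) (sum-map-zero rest (λ y∈ → f≗0 (proj₁ (rest⊆ y∈)) (proj₂ (rest⊆ y∈)))))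
           (ℤₚ.+-identityʳ (f x)))
    where open Removal (remove xs! x∈xs)

  sum-map-pair : ∀ {x y xs f} → Unique xs → x ∈ xs → y ∈ xs → y ≢ x →
                 (∀ {z} → z ∈ xs → z ≢ x → z ≢ y → f z ≡ + 0) → sumℤ (map f xs) ≡ f x + f y
  sum-map-pair {x} {y} {xs} {f} xs! x∈xs y∈xs y≢x f≗0 = trans (sum-split f)
    (cong (_+_ (f x)) (sum-map-single rest-unique (⊆rest y∈xs y≢x)
                         (λ z∈ → f≗0 (proj₁ (rest⊆ z∈)) (proj₂ (rest⊆ z∈)))))
    where open Removal (remove xs! x∈xs)

  sum-map-except : ∀ {x xs f g} → Unique xs → x ∈ xs → (∀ {y} → y ∈ xs → y ≢ x → f y ≡ g y) →
                   sumℤ (map f xs) + g x ≡ sumℤ (map g xs) + f x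
  sum-map-except {x} {xs} {f} {g} xs! x∈xs f≗g = begin
    sumℤ (map f xs) + g x             ≡⟨ cong (_+ g x) (sum-split f) ⟩
    (f x + sumℤ (map f rest)) + g x   ≡⟨ cong (λ s → (f x + s) + g x) (sum-map-cong rest (λ y∈ → f≗g (proj₁ (rest⊆ y∈)) (proj₂ (rest⊆ y∈)))) ⟩
    (f x + sumℤ (map g rest)) + g x   ≡⟨ swap-outer (f x) (sumℤ (map g rest)) (g x) ⟩
    (g x + sumℤ (map g rest)) + f x   ≡⟨ cong (_+ f x) (sym (sum-split g)) ⟩
    sumℤ (map g xs) + f x             ∎
    where
    open ≡-Reasoning
    open Removal (remove xs! x∈xs)
    swap-outer : ∀ a s b → (a + s) + b ≡ (b + s) + a
    swap-outer = solve-∀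

sumℤ-++ : ∀ xs ys → sumℤ (xs ++ ys) ≡ sumℤ xs + sumℤ ys
sumℤ-++ []       ys = sym (ℤₚ.+-identityˡ (sumℤ ys))
sumℤ-++ (x ∷ xs) ys = trans (cong (_+_ x) (sumℤ-++ xs ys)) (sym (ℤₚ.+-assoc x (sumℤ xs) (sumℤ ys)))

module _ {a b} {A : Set a} {B : Set b} where

  pairs : (A → List B) → List A → List (A × B)
  pairs h []       = []
  pairs h (x ∷ xs) = map (x ,_) (h x) ++ pairs h xs

  sum-map-pairs : ∀ (g : A × B → ℤ) h xs →
    sumℤ (map g (pairs h xs)) ≡ sumℤ (map (λ x → sumℤ (map (λ y → g (x , y)) (h x))) xs)
  sum-map-pairs g h []       = refl
  sum-map-pairs g h (x ∷ xs) = begin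
    sumℤ (map g (map (x ,_) (h x) ++ pairs h xs))
      ≡⟨ cong sumℤ (map-++ g (map (x ,_) (h x)) (pairs h xs)) ⟩
    sumℤ (map g (map (x ,_) (h x)) ++ map g (pairs h xs))
      ≡⟨ sumℤ-++ (map g (map (x ,_) (h x))) (map g (pairs h xs)) ⟩
    sumℤ (map g (map (x ,_) (h x))) + sumℤ (map g (pairs h xs))
      ≡⟨ cong₂ _+_ (cong sumℤ (sym (map-∘ (h x)))) (sum-map-pairs g h xs) ⟩
    sumℤ (map (λ y → g (x , y)) (h x)) + sumℤ (map (λ x → sumℤ (map (λ y → g (x , y)) (h x))) xs)
      ∎
    where open ≡-Reasoning

  ∈-pairs⁻ : ∀ {h} xs {p} → p ∈ pairs h xs → proj₁ p ∈ xs × proj₂ p ∈ h (proj₁ p)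
  ∈-pairs⁻ {h} (x ∷ xs) p∈ with ∈-++⁻ (map (x ,_) (h x)) p∈
  ... | inj₁ p∈x×hx with _ , y∈ , refl ← ∈-map⁻ (x ,_) p∈x×hx = here refl , y∈
  ... | inj₂ p∈rest = let x∈ , y∈ = ∈-pairs⁻ xs p∈rest in there x∈ , y∈

  ∈-pairs⁺ : ∀ {h} xs {x y} → x ∈ xs → y ∈ h x → (x , y) ∈ pairs h xs
  ∈-pairs⁺ {h} (x ∷ xs) (here refl) y∈ = ∈-++⁺ˡ (∈-map⁺ (x ,_) y∈)
  ∈-pairs⁺ {h} (x ∷ xs) (there x∈) y∈ = ∈-++⁺ʳ (map (x ,_) (h x)) (∈-pairs⁺ xs x∈ y∈)

  pairs-unique : ∀ {h} xs → Unique xs → (∀ x → Unique (h x)) → Unique (pairs h xs)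
  pairs-unique         []       _               _  = AllPairs.[]
  pairs-unique {h} (x ∷ xs) (x∉xs AllPairs.∷ xs!) h! =
    Unique.++⁺ (Unique.map⁺ (cong proj₂) (h! x)) (pairs-unique xs xs! h!) disjoint
    where
    disjoint : ∀ {p} → p ∈ map (x ,_) (h x) × p ∈ pairs h xs → ⊥
    disjoint (p∈x×hx , p∈rest) with _ , _ , refl ← ∈-map⁻ (x ,_) p∈x×hx =
      All.lookup x∉xs (proj₁ (∈-pairs⁻ xs p∈rest)) refl

-- Formal power series over ℤ

infixl 6 _+ₚ_
infixr 7 _·ₚ_

_+ₚ_ : Poly → Poly → Poly
(p +ₚ q) k = p k + q k

_·ₚ_ : ℤ → Poly → Poly
(a ·ₚ p) k = a * p k

0ₚ : Poly
0ₚ _ = + 0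

1ₚ : Poly
1ₚ = constₚ (+ 1)

X : Poly
X zero    = + 0
X (suc k) = 1ₚ k

tailₚ : Poly → Poly
tailₚ p k = p (suc k)

≈ₚ-setoid : Setoid _ _
≈ₚ-setoid = record
  { Carrier       = Poly
  ; _≈_           = _≈ₚ_
  ; isEquivalence = record
    { refl  = λ _ → refl
    ; sym   = λ e k → sym (e k)
    ; trans = λ e f k → trans (e k) (f k)
    }
  }

open Setoid ≈ₚ-setoid public using () renaming (refl to ≈ₚ-refl; sym to ≈ₚ-sym; trans to ≈ₚ-trans)
module ≈ₚ-Reasoning = SetoidReasoning ≈ₚ-setoid

+ₚ-cong : ∀ {p p′ q q′} → p ≈ₚ p′ → q ≈ₚ q′ → p +ₚ q ≈ₚ p′ +ₚ q′
+ₚ-cong e f k = cong₂ _+_ (e k) (f k)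

·ₚ-congʳ : ∀ a {p q} → p ≈ₚ q → a ·ₚ p ≈ₚ a ·ₚ q
·ₚ-congʳ a e k = cong (a *_) (e k)

constₚ-zero : constₚ (+ 0) ≈ₚ 0ₚ
constₚ-zero zero    = refl
constₚ-zero (suc k) = refl

*ₚ-coeff₀ : ∀ p q → (p *ₚ q) 0 ≡ p 0 * q 0
*ₚ-coeff₀ p q = ℤₚ.+-identityʳ (p 0 * q 0)

*ₚ-coeffSuc : ∀ p q k → (p *ₚ q) (suc k) ≡ p 0 * q (suc k) + (tailₚ p *ₚ q) k
*ₚ-coeffSuc p q k = trans (unfold p q (suc k)) (cong (_+_ (p 0 * q (suc k))) (sym (unfold (tailₚ p) q k)))
  where
  unfold : ∀ p q k → (p *ₚ q) k ≡ sumℤ (applyUpTo (λ i → p i * q (k ∸ i)) (suc k))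
  unfold p q k = cong sumℤ (map-upTo (λ i → p i * q (k ∸ i)) (suc k))

*ₚ-congˡ : ∀ {p p′} q → p ≈ₚ p′ → p *ₚ q ≈ₚ p′ *ₚ q
*ₚ-congˡ {p} {p′} q e zero    = trans (*ₚ-coeff₀ p q) (trans (cong (_* q 0) (e 0)) (sym (*ₚ-coeff₀ p′ q)))
*ₚ-congˡ {p} {p′} q e (suc k) = trans (*ₚ-coeffSuc p q k)
  (trans (cong₂ _+_ (cong (_* q (suc k)) (e 0)) (*ₚ-congˡ q (e ∘ suc) k)) (sym (*ₚ-coeffSuc p′ q k)))

*ₚ-congʳ : ∀ p {q q′} → q ≈ₚ q′ → p *ₚ q ≈ₚ p *ₚ q′
*ₚ-congʳ p {q} {q′} e zero    = trans (*ₚ-coeff₀ p q) (trans (cong (p 0 *_) (e 0)) (sym (*ₚ-coeff₀ p q′)))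
*ₚ-congʳ p {q} {q′} e (suc k) = trans (*ₚ-coeffSuc p q k)
  (trans (cong₂ _+_ (cong (p 0 *_) (e (suc k))) (*ₚ-congʳ (tailₚ p) e k)) (sym (*ₚ-coeffSuc p q′ k)))

*ₚ-zeroˡ : ∀ q → 0ₚ *ₚ q ≈ₚ 0ₚ
*ₚ-zeroˡ q zero    = trans (*ₚ-coeff₀ 0ₚ q) (ℤₚ.*-zeroˡ (q 0))
*ₚ-zeroˡ q (suc k) = trans (*ₚ-coeffSuc 0ₚ q k) (cong₂ _+_ (ℤₚ.*-zeroˡ (q (suc k))) (*ₚ-zeroˡ q k))

*ₚ-distribʳ-+ₚ : ∀ p p′ q → (p +ₚ p′) *ₚ q ≈ₚ p *ₚ q +ₚ p′ *ₚ q
*ₚ-distribʳ-+ₚ p p′ q zero = begin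
  ((p +ₚ p′) *ₚ q) 0      ≡⟨ *ₚ-coeff₀ (p +ₚ p′) q ⟩
  (p 0 + p′ 0) * q 0      ≡⟨ ℤₚ.*-distribʳ-+ (q 0) (p 0) (p′ 0) ⟩
  p 0 * q 0 + p′ 0 * q 0  ≡⟨ sym (cong₂ _+_ (*ₚ-coeff₀ p q) (*ₚ-coeff₀ p′ q)) ⟩
  (p *ₚ q +ₚ p′ *ₚ q) 0   ∎
  where open ≡-Reasoning
*ₚ-distribʳ-+ₚ p p′ q (suc k) = begin
  ((p +ₚ p′) *ₚ q) (suc k)                                     ≡⟨ *ₚ-coeffSuc (p +ₚ p′) q k ⟩
  (p 0 + p′ 0) * q (suc k) + ((tailₚ p +ₚ tailₚ p′) *ₚ q) k     ≡⟨ cong₂ _+_ (ℤₚ.*-distribʳ-+ (q (suc k)) (p 0) (p′ 0))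
                                                                            (*ₚ-distribʳ-+ₚ (tailₚ p) (tailₚ p′) q k) ⟩
  (a + a′) + (b + b′)                                          ≡⟨ interchange a a′ b b′ ⟩
  (a + b) + (a′ + b′)                                          ≡⟨ sym (cong₂ _+_ (*ₚ-coeffSuc p q k) (*ₚ-coeffSuc p′ q k)) ⟩
  (p *ₚ q +ₚ p′ *ₚ q) (suc k)                                  ∎
  where
  open ≡-Reasoning
  a = p 0 * q (suc k)
  a′ = p′ 0 * q (suc k)
  b = (tailₚ p *ₚ q) k
  b′ = (tailₚ p′ *ₚ q) k

*ₚ-assoc-·ₚ : ∀ a p q → (a ·ₚ p) *ₚ q ≈ₚ a ·ₚ (p *ₚ q)
*ₚ-assoc-·ₚ a p q zero = trans (*ₚ-coeff₀ (a ·ₚ p) q)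
  (trans (ℤₚ.*-assoc a (p 0) (q 0)) (cong (a *_) (sym (*ₚ-coeff₀ p q))))
*ₚ-assoc-·ₚ a p q (suc k) = trans (*ₚ-coeffSuc (a ·ₚ p) q k)
  (trans (cong₂ _+_ (ℤₚ.*-assoc a (p 0) (q (suc k))) (*ₚ-assoc-·ₚ a (tailₚ p) q k))
  (trans (sym (ℤₚ.*-distribˡ-+ a _ _)) (cong (a *_) (sym (*ₚ-coeffSuc p q k)))))

constₚ-*ₚ : ∀ a q → constₚ a *ₚ q ≈ₚ a ·ₚ q
constₚ-*ₚ a q zero    = *ₚ-coeff₀ (constₚ a) q
constₚ-*ₚ a q (suc k) = trans (*ₚ-coeffSuc (constₚ a) q k)
  (trans (cong (_+_ (a * q (suc k))) (*ₚ-zeroˡ q k)) (ℤₚ.+-identityʳ _))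

*ₚ-identityˡ : ∀ q → 1ₚ *ₚ q ≈ₚ q
*ₚ-identityˡ q k = trans (constₚ-*ₚ (+ 1) q k) (ℤₚ.*-identityˡ (q k))

*ₚ-comm : ∀ p q → p *ₚ q ≈ₚ q *ₚ p
*ₚ-comm p q zero = trans (*ₚ-coeff₀ p q) (trans (ℤₚ.*-comm (p 0) (q 0)) (sym (*ₚ-coeff₀ q p)))
*ₚ-comm p q (suc zero) = begin
  (p *ₚ q) 1              ≡⟨ trans (*ₚ-coeffSuc p q 0) (cong (_+_ (p 0 * q 1)) (*ₚ-coeff₀ (tailₚ p) q)) ⟩
  p 0 * q 1 + p 1 * q 0   ≡⟨ cross (p 0) (q 0) (p 1) (q 1) ⟩
  q 0 * p 1 + q 1 * p 0   ≡⟨ sym (trans (*ₚ-coeffSuc q p 0) (cong (_+_ (q 0 * p 1)) (*ₚ-coeff₀ (tailₚ q) p))) ⟩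
  (q *ₚ p) 1              ∎
  where
  open ≡-Reasoning
  cross : ∀ a b a′ b′ → a * b′ + a′ * b ≡ b * a′ + b′ * a
  cross = solve-∀
*ₚ-comm p q (suc (suc k)) = begin
  (p *ₚ q) (suc (suc k))                   ≡⟨ *ₚ-coeffSuc p q (suc k) ⟩
  a + (tailₚ p *ₚ q) (suc k)               ≡⟨ cong (_+_ a) (*ₚ-comm (tailₚ p) q (suc k)) ⟩
  a + (q *ₚ tailₚ p) (suc k)               ≡⟨ cong (_+_ a) (*ₚ-coeffSuc q (tailₚ p) k) ⟩
  a + (b + (tailₚ q *ₚ tailₚ p) k)         ≡⟨ cong (λ z → a + (b + z)) (*ₚ-comm (tailₚ q) (tailₚ p) k) ⟩
  a + (b + (tailₚ p *ₚ tailₚ q) k)         ≡⟨ +-left-comm a b _ ⟩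
  b + (a + (tailₚ p *ₚ tailₚ q) k)         ≡⟨ cong (_+_ b) (sym (*ₚ-coeffSuc p (tailₚ q) k)) ⟩
  b + (p *ₚ tailₚ q) (suc k)               ≡⟨ cong (_+_ b) (*ₚ-comm p (tailₚ q) (suc k)) ⟩
  b + (tailₚ q *ₚ p) (suc k)               ≡⟨ sym (*ₚ-coeffSuc q p (suc k)) ⟩
  (q *ₚ p) (suc (suc k))                   ∎
  where
  open ≡-Reasoning
  a = p 0 * q (suc (suc k))
  b = q 0 * p (suc (suc k))

*ₚ-assoc : ∀ p q r → (p *ₚ q) *ₚ r ≈ₚ p *ₚ (q *ₚ r)
*ₚ-assoc p q r zero = begin
  ((p *ₚ q) *ₚ r) 0    ≡⟨ trans (*ₚ-coeff₀ (p *ₚ q) r) (cong (_* r 0) (*ₚ-coeff₀ p q)) ⟩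
  p 0 * q 0 * r 0      ≡⟨ ℤₚ.*-assoc (p 0) (q 0) (r 0) ⟩
  p 0 * (q 0 * r 0)    ≡⟨ sym (trans (*ₚ-coeff₀ p (q *ₚ r)) (cong (p 0 *_) (*ₚ-coeff₀ q r))) ⟩
  (p *ₚ (q *ₚ r)) 0    ∎
  where open ≡-Reasoning
*ₚ-assoc p q r (suc k) = begin
  ((p *ₚ q) *ₚ r) (suc k)
    ≡⟨ *ₚ-coeffSuc (p *ₚ q) r k ⟩
  (p *ₚ q) 0 * r (suc k) + (tailₚ (p *ₚ q) *ₚ r) k
    ≡⟨ cong₂ _+_ (cong (_* r (suc k)) (*ₚ-coeff₀ p q)) (*ₚ-congˡ r (*ₚ-coeffSuc p q) k) ⟩
  p 0 * q 0 * r (suc k) + ((p 0 ·ₚ tailₚ q +ₚ tailₚ p *ₚ q) *ₚ r) k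
    ≡⟨ cong (_+_ (p 0 * q 0 * r (suc k))) (*ₚ-distribʳ-+ₚ (p 0 ·ₚ tailₚ q) (tailₚ p *ₚ q) r k) ⟩
  p 0 * q 0 * r (suc k) + (((p 0 ·ₚ tailₚ q) *ₚ r) k + ((tailₚ p *ₚ q) *ₚ r) k)
    ≡⟨ cong (_+_ (p 0 * q 0 * r (suc k))) (cong₂ _+_ (*ₚ-assoc-·ₚ (p 0) (tailₚ q) r k) (*ₚ-assoc (tailₚ p) q r k)) ⟩
  p 0 * q 0 * r (suc k) + (p 0 * (tailₚ q *ₚ r) k + (tailₚ p *ₚ (q *ₚ r)) k)
    ≡⟨ regroup (p 0) (q 0) (r (suc k)) ((tailₚ q *ₚ r) k) ((tailₚ p *ₚ (q *ₚ r)) k) ⟩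
  p 0 * (q 0 * r (suc k) + (tailₚ q *ₚ r) k) + (tailₚ p *ₚ (q *ₚ r)) k
    ≡⟨ cong (λ z → p 0 * z + (tailₚ p *ₚ (q *ₚ r)) k) (sym (*ₚ-coeffSuc q r k)) ⟩
  p 0 * (q *ₚ r) (suc k) + (tailₚ p *ₚ (q *ₚ r)) k
    ≡⟨ sym (*ₚ-coeffSuc p (q *ₚ r) k) ⟩
  (p *ₚ (q *ₚ r)) (suc k)
    ∎
  where
  open ≡-Reasoning
  regroup : ∀ a b c d e → a * b * c + (a * d + e) ≡ a * (b * c + d) + e
  regroup = solve-∀

*ₚ-distribˡ-+ₚ : ∀ p q q′ → p *ₚ (q +ₚ q′) ≈ₚ p *ₚ q +ₚ p *ₚ q′
*ₚ-distribˡ-+ₚ p q q′ k = trans (*ₚ-comm p (q +ₚ q′) k)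
  (trans (*ₚ-distribʳ-+ₚ q q′ p k) (cong₂ _+_ (*ₚ-comm q p k) (*ₚ-comm q′ p k)))

*ₚ-zeroʳ : ∀ p → p *ₚ 0ₚ ≈ₚ 0ₚ
*ₚ-zeroʳ p k = trans (*ₚ-comm p 0ₚ k) (*ₚ-zeroˡ p k)

*ₚ-identityʳ : ∀ p → p *ₚ 1ₚ ≈ₚ p
*ₚ-identityʳ p k = trans (*ₚ-comm p 1ₚ k) (*ₚ-identityˡ p k)

*ₚ-constₚ : ∀ a p → p *ₚ constₚ a ≈ₚ a ·ₚ p
*ₚ-constₚ a p k = trans (*ₚ-comm p (constₚ a) k) (constₚ-*ₚ a p k)

*ₚ-·ₚ : ∀ a p q → p *ₚ (a ·ₚ q) ≈ₚ a ·ₚ (p *ₚ q)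
*ₚ-·ₚ a p q k = trans (*ₚ-comm p (a ·ₚ q) k) (trans (*ₚ-assoc-·ₚ a q p k) (cong (a *_) (*ₚ-comm q p k)))

*ₚ-left-comm : ∀ p q r → p *ₚ (q *ₚ r) ≈ₚ q *ₚ (p *ₚ r)
*ₚ-left-comm p q r = begin
  p *ₚ (q *ₚ r)   ≈⟨ ≈ₚ-sym (*ₚ-assoc p q r) ⟩
  (p *ₚ q) *ₚ r   ≈⟨ *ₚ-congˡ r (*ₚ-comm p q) ⟩
  (q *ₚ p) *ₚ r   ≈⟨ *ₚ-assoc q p r ⟩
  q *ₚ (p *ₚ r)   ∎
  where open ≈ₚ-Reasoning

constₚ≈·ₚ1ₚ : ∀ a → constₚ a ≈ₚ a ·ₚ 1ₚ
constₚ≈·ₚ1ₚ a zero    = sym (ℤₚ.*-identityʳ a)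
constₚ≈·ₚ1ₚ a (suc k) = sym (ℤₚ.*-zeroʳ a)

-1·ₚ-cancel : ∀ {p q} → - (+ 1) ·ₚ p ≈ₚ - (+ 1) ·ₚ q → p ≈ₚ q
-1·ₚ-cancel {p} {q} e k = ℤₚ.neg-injective (trans (sym (ℤₚ.-1*i≡-i (p k))) (trans (e k) (ℤₚ.-1*i≡-i (q k))))

X*ₚ-coeff₀ : ∀ q → (X *ₚ q) 0 ≡ + 0
X*ₚ-coeff₀ q = trans (*ₚ-coeff₀ X q) (ℤₚ.*-zeroˡ (q 0))

X*ₚ-coeffSuc : ∀ q k → (X *ₚ q) (suc k) ≡ q k
X*ₚ-coeffSuc q k = trans (*ₚ-coeffSuc X q k)
  (trans (cong₂ _+_ (ℤₚ.*-zeroˡ (q (suc k))) (*ₚ-identityˡ q k)) (ℤₚ.+-identityˡ (q k)))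

x-1*ₚ-coeff₀ : ∀ q → (x-1 *ₚ q) 0 ≡ - q 0
x-1*ₚ-coeff₀ q = trans (*ₚ-coeff₀ x-1 q) (ℤₚ.-1*i≡-i (q 0))

x-1*ₚ-coeffSuc : ∀ q k → (x-1 *ₚ q) (suc k) ≡ q k - q (suc k)
x-1*ₚ-coeffSuc q k = trans (*ₚ-coeffSuc x-1 q k)
  (trans (cong₂ _+_ (ℤₚ.-1*i≡-i (q (suc k))) (trans (*ₚ-congˡ q tail-x-1 k) (*ₚ-identityˡ q k)))
         (ℤₚ.+-comm (- q (suc k)) (q k)))
  where
  tail-x-1 : tailₚ x-1 ≈ₚ 1ₚ
  tail-x-1 zero    = refl
  tail-x-1 (suc k) = refl

x-1*ₚ-recover₀ : ∀ q → q 0 ≡ - (x-1 *ₚ q) 0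
x-1*ₚ-recover₀ q = trans (sym (ℤₚ.neg-involutive (q 0))) (cong -_ (sym (x-1*ₚ-coeff₀ q)))

x-1*ₚ-recoverSuc : ∀ q k → q (suc k) ≡ q k - (x-1 *ₚ q) (suc k)
x-1*ₚ-recoverSuc q k = trans (sub-sub (q k) (q (suc k))) (cong (λ z → q k - z) (sym (x-1*ₚ-coeffSuc q k)))
  where
  sub-sub : ∀ a b → b ≡ a - (a - b)
  sub-sub = solve-∀

x-1*ₚ-cancel : ∀ {q q′} → x-1 *ₚ q ≈ₚ x-1 *ₚ q′ → q ≈ₚ q′
x-1*ₚ-cancel {q} {q′} e zero    = trans (x-1*ₚ-recover₀ q) (trans (cong -_ (e 0)) (sym (x-1*ₚ-recover₀ q′)))
x-1*ₚ-cancel {q} {q′} e (suc k) = trans (x-1*ₚ-recoverSuc q k)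
  (trans (cong₂ _-_ (x-1*ₚ-cancel {q} {q′} e k) (e (suc k))) (sym (x-1*ₚ-recoverSuc q′ k)))

X*ₚ≈+ₚx-1*ₚ : ∀ q → X *ₚ q ≈ₚ q +ₚ x-1 *ₚ q
X*ₚ≈+ₚx-1*ₚ q zero = begin
  (X *ₚ q) 0            ≡⟨ X*ₚ-coeff₀ q ⟩
  + 0                   ≡⟨ sym (ℤₚ.+-inverseʳ (q 0)) ⟩
  q 0 - q 0             ≡⟨ cong (_+_ (q 0)) (sym (x-1*ₚ-coeff₀ q)) ⟩
  (q +ₚ x-1 *ₚ q) 0     ∎
  where open ≡-Reasoning
X*ₚ≈+ₚx-1*ₚ q (suc k) = begin
  (X *ₚ q) (suc k)                 ≡⟨ X*ₚ-coeffSuc q k ⟩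
  q k                              ≡⟨ cancel (q (suc k)) (q k) ⟩
  q (suc k) + (q k - q (suc k))    ≡⟨ cong (_+_ (q (suc k))) (sym (x-1*ₚ-coeffSuc q k)) ⟩
  (q +ₚ x-1 *ₚ q) (suc k)          ∎
  where
  open ≡-Reasoning
  cancel : ∀ a b → b ≡ a + (b - a)
  cancel = solve-∀

X^ : ℕ → Poly
X^ zero    = 1ₚ
X^ (suc m) = X *ₚ X^ m

*ₚ-head+tail : ∀ p q → p *ₚ q ≈ₚ p 0 ·ₚ q +ₚ X *ₚ (tailₚ p *ₚ q)
*ₚ-head+tail p q zero    = trans (*ₚ-coeff₀ p q)
  (sym (trans (cong (_+_ (p 0 * q 0)) (X*ₚ-coeff₀ (tailₚ p *ₚ q))) (ℤₚ.+-identityʳ (p 0 * q 0))))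
*ₚ-head+tail p q (suc k) = trans (*ₚ-coeffSuc p q k)
  (cong (_+_ (p 0 * q (suc k))) (sym (X*ₚ-coeffSuc (tailₚ p *ₚ q) k)))

∑ₚ : ∀ {a} {A : Set a} → List A → (A → Poly) → Poly
∑ₚ xs f k = sumℤ (map (λ w → f w k) xs)

*ₚ-distribʳ-∑ₚ : ∀ {a} {A : Set a} (xs : List A) f q → ∑ₚ xs f *ₚ q ≈ₚ ∑ₚ xs (λ w → f w *ₚ q)
*ₚ-distribʳ-∑ₚ []       f q = *ₚ-zeroˡ q
*ₚ-distribʳ-∑ₚ (x ∷ xs) f q k = trans (*ₚ-distribʳ-+ₚ (f x) (∑ₚ xs f) q k)
  (cong (_+_ ((f x *ₚ q) k)) (*ₚ-distribʳ-∑ₚ xs f q k))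

*ₚ-distribˡ-∑ₚ : ∀ {a} {A : Set a} (xs : List A) f p → p *ₚ ∑ₚ xs f ≈ₚ ∑ₚ xs (λ w → p *ₚ f w)
*ₚ-distribˡ-∑ₚ []       f p = *ₚ-zeroʳ p
*ₚ-distribˡ-∑ₚ (x ∷ xs) f p k = trans (*ₚ-distribˡ-+ₚ p (f x) (∑ₚ xs f) k)
  (cong (_+_ ((p *ₚ f x) k)) (*ₚ-distribˡ-∑ₚ xs f p k))

DegLe-mono : ∀ {p m n} → DegLe p m → m ℕ.≤ n → DegLe p n
DegLe-mono p≤m m≤n k n<k = p≤m k (ℕₚ.≤-<-trans m≤n n<k)

DegLe-tailₚ : ∀ {p d} → DegLe p (suc d) → DegLe (tailₚ p) d
DegLe-tailₚ p≤d k d<k = p≤d (suc k) (s≤s d<k)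

DegLe-zero⇒constₚ : ∀ {p} → DegLe p 0 → p ≈ₚ constₚ (p 0)
DegLe-zero⇒constₚ p≤0 zero    = refl
DegLe-zero⇒constₚ p≤0 (suc k) = p≤0 (suc k) (s≤s z≤n)

DegLe-constₚ : ∀ a d → DegLe (constₚ a) d
DegLe-constₚ a d zero    ()
DegLe-constₚ a d (suc k) _ = refl

*ₚ-DegLe : ∀ {p q} m n → DegLe p m → DegLe q n → DegLe (p *ₚ q) (m ℕ.+ n)
*ₚ-DegLe         m       n p≤m q≤n zero    ()
*ₚ-DegLe {p} {q} zero    n p≤m q≤n (suc k) n<k = trans (*ₚ-coeffSuc p q k)
  (cong₂ _+_ (trans (cong (p 0 *_) (q≤n (suc k) n<k)) (ℤₚ.*-zeroʳ (p 0)))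
             (trans (*ₚ-congˡ q (λ j → p≤m (suc j) (s≤s z≤n)) k) (*ₚ-zeroˡ q k)))
*ₚ-DegLe {p} {q} (suc m) n p≤m q≤n (suc k) m+n<k = trans (*ₚ-coeffSuc p q k)
  (cong₂ _+_ (trans (cong (p 0 *_) (q≤n (suc k) (ℕₚ.≤-<-trans (ℕₚ.m≤n+m n (suc m)) m+n<k))) (ℤₚ.*-zeroʳ (p 0)))
             (*ₚ-DegLe m n (DegLe-tailₚ p≤m) q≤n k (ℕₚ.≤-pred m+n<k)))

revAt-≤ : ∀ {d k} p → k ℕ.≤ d → revAt d p k ≡ p (d ∸ k)
revAt-≤ {d} {k} p k≤d with k ≤ᵇ d | ℕₚ.≤⇒≤ᵇ k≤d
... | true | _ = refl

revAt-> : ∀ {d k} p → d ℕ.< k → revAt d p k ≡ + 0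
revAt-> {d} {k} p d<k with k ≤ᵇ d | ℕₚ.≤ᵇ⇒≤ k d
... | false | _   = refl
... | true  | k≤d = ⊥-elim (ℕₚ.<⇒≱ d<k (k≤d _))

revAt-coeffSuc : ∀ d p k → revAt (suc d) p (suc k) ≡ revAt d p k
revAt-coeffSuc d p zero    = refl
revAt-coeffSuc d p (suc k) = refl

revAt-DegLe : ∀ d p → DegLe (revAt d p) d
revAt-DegLe d p k d<k = revAt-> p d<k

revAt-cong : ∀ d {p q} → p ≈ₚ q → revAt d p ≈ₚ revAt d q
revAt-cong d e k with k ≤ᵇ d
... | true  = e (d ∸ k)
... | false = refl

revAt-+ₚ : ∀ d p q → revAt d (p +ₚ q) ≈ₚ revAt d p +ₚ revAt d q
revAt-+ₚ d p q k with k ≤ᵇ d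
... | true  = refl
... | false = refl

revAt-·ₚ : ∀ d a p → revAt d (a ·ₚ p) ≈ₚ a ·ₚ revAt d p
revAt-·ₚ d a p k with k ≤ᵇ d
... | true  = refl
... | false = sym (ℤₚ.*-zeroʳ a)

revAt-∑ₚ : ∀ {a} {A : Set a} d (xs : List A) f → revAt d (∑ₚ xs f) ≈ₚ ∑ₚ xs (λ w → revAt d (f w))
revAt-∑ₚ d xs f k with k ≤ᵇ d
... | true  = refl
... | false = sym (sum-map-zero xs (λ _ → refl))

revAt-zero : ∀ {p} → DegLe p 0 → revAt 0 p ≈ₚ p
revAt-zero p≤0 zero    = refl
revAt-zero p≤0 (suc k) = sym (p≤0 (suc k) (s≤s z≤n))

revAt-X*ₚ : ∀ d q → revAt (suc d) (X *ₚ q) ≈ₚ revAt d q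
revAt-X*ₚ d q k with k ℕₚ.≤? d | k ℕₚ.≤? suc d
... | yes k≤d | _ = begin
  revAt (suc d) (X *ₚ q) k   ≡⟨ revAt-≤ (X *ₚ q) (ℕₚ.m≤n⇒m≤1+n k≤d) ⟩
  (X *ₚ q) (suc d ∸ k)       ≡⟨ cong (X *ₚ q) (ℕₚ.+-∸-assoc 1 k≤d) ⟩
  (X *ₚ q) (suc (d ∸ k))     ≡⟨ X*ₚ-coeffSuc q (d ∸ k) ⟩
  q (d ∸ k)                  ≡⟨ sym (revAt-≤ q k≤d) ⟩
  revAt d q k                ∎
  where open ≡-Reasoning
... | no k≰d | yes k≤1+d = begin
  revAt (suc d) (X *ₚ q) k   ≡⟨ revAt-≤ (X *ₚ q) k≤1+d ⟩
  (X *ₚ q) (suc d ∸ k)       ≡⟨ cong (X *ₚ q) (ℕₚ.m≤n⇒m∸n≡0 (ℕₚ.≰⇒> k≰d)) ⟩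
  (X *ₚ q) 0                 ≡⟨ X*ₚ-coeff₀ q ⟩
  + 0                        ≡⟨ sym (revAt-> q (ℕₚ.≰⇒> k≰d)) ⟩
  revAt d q k                ∎
  where open ≡-Reasoning
... | no k≰d | no k≰1+d = trans (revAt-> (X *ₚ q) (ℕₚ.≰⇒> k≰1+d)) (sym (revAt-> q (ℕₚ.≰⇒> k≰d)))

revAt-suc : ∀ d q → DegLe q d → revAt (suc d) q ≈ₚ X *ₚ revAt d q
revAt-suc d q q≤d zero    = trans (revAt-≤ q z≤n) (trans (q≤d (suc d) (ℕₚ.n<1+n d)) (sym (X*ₚ-coeff₀ (revAt d q))))
revAt-suc d q q≤d (suc k) = trans (revAt-coeffSuc d q k) (sym (X*ₚ-coeffSuc (revAt d q) k))

revAt-1ₚ : ∀ m → revAt m 1ₚ ≈ₚ X^ m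
revAt-1ₚ zero    = revAt-zero (DegLe-constₚ (+ 1) 0)
revAt-1ₚ (suc m) = ≈ₚ-trans (revAt-suc m 1ₚ (DegLe-constₚ (+ 1) m)) (*ₚ-congʳ X (revAt-1ₚ m))

revAt-≈1ₚ : ∀ {d p} → d ≡ 0 → p ≈ₚ 1ₚ → revAt d p ≈ₚ 1ₚ
revAt-≈1ₚ refl p≈1 = ≈ₚ-trans (revAt-cong 0 p≈1) (revAt-1ₚ 0)

revAt-raise : ∀ m n q → DegLe q n → revAt (m ℕ.+ n) q ≈ₚ X^ m *ₚ revAt n q
revAt-raise zero    n q q≤n = ≈ₚ-sym (*ₚ-identityˡ (revAt n q))
revAt-raise (suc m) n q q≤n = begin
  revAt (suc (m ℕ.+ n)) q         ≈⟨ revAt-suc (m ℕ.+ n) q (DegLe-mono q≤n (ℕₚ.m≤n+m n m)) ⟩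
  X *ₚ revAt (m ℕ.+ n) q          ≈⟨ *ₚ-congʳ X (revAt-raise m n q q≤n) ⟩
  X *ₚ (X^ m *ₚ revAt n q)        ≈⟨ ≈ₚ-sym (*ₚ-assoc X (X^ m) (revAt n q)) ⟩
  X^ (suc m) *ₚ revAt n q         ∎
  where open ≈ₚ-Reasoning

revAt-head+tail : ∀ m p → revAt (suc m) p ≈ₚ p 0 ·ₚ X^ (suc m) +ₚ revAt m (tailₚ p)
revAt-head+tail m p = begin
  revAt (suc m) p                                             ≈⟨ revAt-cong (suc m) (head+tail p) ⟩
  revAt (suc m) (p 0 ·ₚ 1ₚ +ₚ X *ₚ tailₚ p)                   ≈⟨ revAt-+ₚ (suc m) (p 0 ·ₚ 1ₚ) (X *ₚ tailₚ p) ⟩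
  revAt (suc m) (p 0 ·ₚ 1ₚ) +ₚ revAt (suc m) (X *ₚ tailₚ p)   ≈⟨ +ₚ-cong (revAt-·ₚ (suc m) (p 0) 1ₚ) (revAt-X*ₚ m (tailₚ p)) ⟩
  p 0 ·ₚ revAt (suc m) 1ₚ +ₚ revAt m (tailₚ p)                ≈⟨ +ₚ-cong (·ₚ-congʳ (p 0) (revAt-1ₚ (suc m))) ≈ₚ-refl ⟩
  p 0 ·ₚ X^ (suc m) +ₚ revAt m (tailₚ p)                      ∎
  where
  open ≈ₚ-Reasoning
  head+tail : ∀ p → p ≈ₚ p 0 ·ₚ 1ₚ +ₚ X *ₚ tailₚ p
  head+tail p = ≈ₚ-trans (≈ₚ-sym (*ₚ-identityʳ p)) (≈ₚ-trans (*ₚ-head+tail p 1ₚ)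
    (λ k → cong (_+_ (p 0 * 1ₚ k)) (*ₚ-congʳ X (*ₚ-identityʳ (tailₚ p)) k)))

revAt-*ₚ : ∀ m n p q → DegLe p m → DegLe q n → revAt (m ℕ.+ n) (p *ₚ q) ≈ₚ revAt m p *ₚ revAt n q
revAt-*ₚ zero n p q p≤0 q≤n = begin
  revAt n (p *ₚ q)               ≈⟨ revAt-cong n (≈ₚ-trans (*ₚ-congˡ q p≈c) (constₚ-*ₚ (p 0) q)) ⟩
  revAt n (p 0 ·ₚ q)             ≈⟨ revAt-·ₚ n (p 0) q ⟩
  p 0 ·ₚ revAt n q               ≈⟨ ≈ₚ-sym (constₚ-*ₚ (p 0) (revAt n q)) ⟩
  constₚ (p 0) *ₚ revAt n q      ≈⟨ *ₚ-congˡ (revAt n q) (≈ₚ-sym (≈ₚ-trans (revAt-zero p≤0) p≈c)) ⟩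
  revAt 0 p *ₚ revAt n q         ∎
  where
  open ≈ₚ-Reasoning
  p≈c = DegLe-zero⇒constₚ p≤0
revAt-*ₚ (suc m) n p q p≤m q≤n = begin
  revAt (suc m ℕ.+ n) (p *ₚ q)
    ≈⟨ revAt-cong (suc m ℕ.+ n) (*ₚ-head+tail p q) ⟩
  revAt (suc m ℕ.+ n) (p 0 ·ₚ q +ₚ X *ₚ (tailₚ p *ₚ q))
    ≈⟨ revAt-+ₚ (suc m ℕ.+ n) (p 0 ·ₚ q) (X *ₚ (tailₚ p *ₚ q)) ⟩
  revAt (suc m ℕ.+ n) (p 0 ·ₚ q) +ₚ revAt (suc m ℕ.+ n) (X *ₚ (tailₚ p *ₚ q))
    ≈⟨ +ₚ-cong (revAt-·ₚ (suc m ℕ.+ n) (p 0) q) (revAt-X*ₚ (m ℕ.+ n) (tailₚ p *ₚ q)) ⟩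
  p 0 ·ₚ revAt (suc m ℕ.+ n) q +ₚ revAt (m ℕ.+ n) (tailₚ p *ₚ q)
    ≈⟨ +ₚ-cong (·ₚ-congʳ (p 0) (revAt-raise (suc m) n q q≤n)) (revAt-*ₚ m n (tailₚ p) q (DegLe-tailₚ p≤m) q≤n) ⟩
  p 0 ·ₚ (X^ (suc m) *ₚ rq) +ₚ revAt m (tailₚ p) *ₚ rq
    ≈⟨ +ₚ-cong (≈ₚ-sym (*ₚ-assoc-·ₚ (p 0) (X^ (suc m)) rq)) ≈ₚ-refl ⟩
  (p 0 ·ₚ X^ (suc m)) *ₚ rq +ₚ revAt m (tailₚ p) *ₚ rq
    ≈⟨ ≈ₚ-sym (*ₚ-distribʳ-+ₚ (p 0 ·ₚ X^ (suc m)) (revAt m (tailₚ p)) rq) ⟩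
  (p 0 ·ₚ X^ (suc m) +ₚ revAt m (tailₚ p)) *ₚ rq
    ≈⟨ *ₚ-congˡ rq (≈ₚ-sym (revAt-head+tail m p)) ⟩
  revAt (suc m) p *ₚ rq
    ∎
  where
  open ≈ₚ-Reasoning
  rq = revAt n q

-- p 0 + ⋯ + p d, which is p(1) whenever deg p ≤ d
eval₁ : ℕ → Poly → ℤ
eval₁ zero    p = p 0
eval₁ (suc d) p = p 0 + eval₁ d (tailₚ p)

eval₁-cong : ∀ d {p q} → p ≈ₚ q → eval₁ d p ≡ eval₁ d q
eval₁-cong zero    e = e 0
eval₁-cong (suc d) e = cong₂ _+_ (e 0) (eval₁-cong d (e ∘ suc))

eval₁-+ₚ : ∀ d p q → eval₁ d (p +ₚ q) ≡ eval₁ d p + eval₁ d q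
eval₁-+ₚ zero    p q = refl
eval₁-+ₚ (suc d) p q = trans (cong (_+_ (p 0 + q 0)) (eval₁-+ₚ d (tailₚ p) (tailₚ q)))
                             (interchange (p 0) (q 0) (eval₁ d (tailₚ p)) (eval₁ d (tailₚ q)))

eval₁-·ₚ : ∀ d a p → eval₁ d (a ·ₚ p) ≡ a * eval₁ d p
eval₁-·ₚ zero    a p = refl
eval₁-·ₚ (suc d) a p = trans (cong (_+_ (a * p 0)) (eval₁-·ₚ d a (tailₚ p))) (sym (ℤₚ.*-distribˡ-+ a _ _))

eval₁-0ₚ : ∀ d → eval₁ d 0ₚ ≡ + 0
eval₁-0ₚ zero    = refl
eval₁-0ₚ (suc d) = trans (ℤₚ.+-identityˡ _) (eval₁-0ₚ d)

eval₁-∑ₚ : ∀ {a} {A : Set a} d (xs : List A) f → eval₁ d (∑ₚ xs f) ≡ sumℤ (map (λ w → eval₁ d (f w)) xs)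
eval₁-∑ₚ d []       f = eval₁-0ₚ d
eval₁-∑ₚ d (x ∷ xs) f = trans (eval₁-+ₚ d (f x) (∑ₚ xs f)) (cong (_+_ (eval₁ d (f x))) (eval₁-∑ₚ d xs f))

eval₁-suc : ∀ d p → eval₁ (suc d) p ≡ eval₁ d p + p (suc d)
eval₁-suc zero    p = refl
eval₁-suc (suc d) p = trans (cong (_+_ (p 0)) (eval₁-suc d (tailₚ p))) (sym (ℤₚ.+-assoc (p 0) _ _))

eval₁-DegLe : ∀ {p d n} → DegLe p d → d ℕ.≤ n → eval₁ n p ≡ eval₁ d p
eval₁-DegLe {p} {d} p≤d d≤n = go (ℕₚ.≤⇒≤′ d≤n)
  where
  go : ∀ {n} → d ℕ.≤′ n → eval₁ n p ≡ eval₁ d p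
  go ℕ.≤′-refl = refl
  go {suc n} (ℕ.≤′-step d≤n) = begin
    eval₁ (suc n) p           ≡⟨ eval₁-suc n p ⟩
    eval₁ n p + p (suc n)     ≡⟨ cong (_+_ (eval₁ n p)) (p≤d (suc n) (s≤s (ℕₚ.≤′⇒≤ d≤n))) ⟩
    eval₁ n p + + 0           ≡⟨ ℤₚ.+-identityʳ (eval₁ n p) ⟩
    eval₁ n p                 ≡⟨ go d≤n ⟩
    eval₁ d p                 ∎
    where open ≡-Reasoning

eval₁-X*ₚ : ∀ d r → eval₁ (suc d) (X *ₚ r) ≡ eval₁ d r
eval₁-X*ₚ d r = trans (cong₂ _+_ (X*ₚ-coeff₀ r) (eval₁-cong d (X*ₚ-coeffSuc r))) (ℤₚ.+-identityˡ (eval₁ d r))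

eval₁-*ₚ : ∀ m n p q → DegLe p m → DegLe q n → eval₁ (m ℕ.+ n) (p *ₚ q) ≡ eval₁ m p * eval₁ n q
eval₁-*ₚ zero n p q p≤0 q≤n = trans (eval₁-cong n (≈ₚ-trans (*ₚ-congˡ q (DegLe-zero⇒constₚ p≤0)) (constₚ-*ₚ (p 0) q)))
                                    (eval₁-·ₚ n (p 0) q)
eval₁-*ₚ (suc m) n p q p≤m q≤n = begin
  eval₁ (suc m ℕ.+ n) (p *ₚ q)
    ≡⟨ eval₁-cong (suc m ℕ.+ n) (*ₚ-head+tail p q) ⟩
  eval₁ (suc m ℕ.+ n) (p 0 ·ₚ q +ₚ X *ₚ (tailₚ p *ₚ q))
    ≡⟨ eval₁-+ₚ (suc m ℕ.+ n) (p 0 ·ₚ q) (X *ₚ (tailₚ p *ₚ q)) ⟩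
  eval₁ (suc m ℕ.+ n) (p 0 ·ₚ q) + eval₁ (suc m ℕ.+ n) (X *ₚ (tailₚ p *ₚ q))
    ≡⟨ cong₂ _+_ (eval₁-·ₚ (suc m ℕ.+ n) (p 0) q) (eval₁-X*ₚ (m ℕ.+ n) (tailₚ p *ₚ q)) ⟩
  p 0 * eval₁ (suc m ℕ.+ n) q + eval₁ (m ℕ.+ n) (tailₚ p *ₚ q)
    ≡⟨ cong₂ _+_ (cong (p 0 *_) (eval₁-DegLe q≤n (ℕₚ.m≤n+m n (suc m)))) (eval₁-*ₚ m n (tailₚ p) q (DegLe-tailₚ p≤m) q≤n) ⟩
  p 0 * eval₁ n q + eval₁ m (tailₚ p) * eval₁ n q
    ≡⟨ sym (ℤₚ.*-distribʳ-+ (eval₁ n q) (p 0) (eval₁ m (tailₚ p))) ⟩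
  eval₁ (suc m) p * eval₁ n q
    ∎
  where open ≡-Reasoning

eval₁-revAt : ∀ d p → eval₁ d (revAt d p) ≡ eval₁ d p
eval₁-revAt zero    p = refl
eval₁-revAt (suc d) p = begin
  p (suc d) + eval₁ d (tailₚ (revAt (suc d) p))   ≡⟨ cong (_+_ (p (suc d))) (eval₁-cong d (revAt-coeffSuc d p)) ⟩
  p (suc d) + eval₁ d (revAt d p)                 ≡⟨ cong (_+_ (p (suc d))) (eval₁-revAt d p) ⟩
  p (suc d) + eval₁ d p                           ≡⟨ ℤₚ.+-comm (p (suc d)) (eval₁ d p) ⟩
  eval₁ d p + p (suc d)                           ≡⟨ sym (eval₁-suc d p) ⟩
  eval₁ (suc d) p                                 ∎
  where open ≡-Reasoning

x-1-quotient : ∀ {p q} → x-1 *ₚ q ≈ₚ p → ∀ k → q k ≡ - eval₁ k p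
x-1-quotient {p} {q} e zero    = trans (x-1*ₚ-recover₀ q) (cong -_ (e 0))
x-1-quotient {p} {q} e (suc k) = begin
  q (suc k)                   ≡⟨ x-1*ₚ-recoverSuc q k ⟩
  q k - (x-1 *ₚ q) (suc k)    ≡⟨ cong₂ _-_ (x-1-quotient {p} {q} e k) (e (suc k)) ⟩
  - eval₁ k p - p (suc k)     ≡⟨ sym (ℤₚ.neg-distrib-+ (eval₁ k p) (p (suc k))) ⟩
  - (eval₁ k p + p (suc k))   ≡⟨ cong -_ (sym (eval₁-suc k p)) ⟩
  - eval₁ (suc k) p           ∎
  where open ≡-Reasoning

x-1-quotient-DegLe : ∀ {p q} d → x-1 *ₚ q ≈ₚ p → DegLe p d → eval₁ d p ≡ + 0 → DegLe q (d ∸ 1)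
x-1-quotient-DegLe {p} {q} d e p≤d p[1]≡0 k d∸1<k = begin
  q k            ≡⟨ x-1-quotient {p} {q} e k ⟩
  - eval₁ k p    ≡⟨ cong -_ (eval₁-DegLe p≤d (∸1<⇒≤ d d∸1<k)) ⟩
  - eval₁ d p    ≡⟨ cong -_ p[1]≡0 ⟩
  + 0            ∎
  where
  open ≡-Reasoning
  ∸1<⇒≤ : ∀ d → d ∸ 1 ℕ.< k → d ℕ.≤ k
  ∸1<⇒≤ zero    _ = z≤n
  ∸1<⇒≤ (suc d) d<k = d<k

-- Incidence algebras

module Incidence {c ℓ} (P : LFPoset c ℓ) where
  open LFPoset P
  open IsPartialOrder isPartialOrder using (antisym) renaming (refl to ≤-refl; trans to ≤-trans)

  infixl 7 _⋆_
  _⋆_ : Inc P → Inc P → Inc P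
  _⋆_ = Defs._⋆_ P

  -- Equality on the carrier need not be decidable; splitting s ≤ t into s ≡ t or s < t is justified
  -- by the decidability of the goal.
  ≤-elim : ∀ {q} (G : Carrier → Carrier → Set q) {s t} → Dec (G s t) →
           (∀ u → G u u) → (s < t → G s t) → s ≤ t → G s t
  ≤-elim G {s} {t} G? on-diag on-< s≤t = decidable-stable G? λ ¬G → ¬¬-excluded-middle {A = s ≡ t} λ where
    (yes refl) → ¬G (on-diag _)
    (no s≢t)   → ¬G (on-< (s≤t , s≢t))

  ∈-interval⁻ : ∀ {s t w} → w ∈ interval s t → s ≤ w × w ≤ t
  ∈-interval⁻ = Equivalence.to (interval-spec _ _ _)

  ∈-interval⁺ : ∀ {s t w} → s ≤ w → w ≤ t → w ∈ interval s t
  ∈-interval⁺ s≤w w≤t = Equivalence.from (interval-spec _ _ _) (s≤w , w≤t)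

  ⋆-congˡ : ∀ {a a′} b {s t} → (∀ {w} → s ≤ w → w ≤ t → a s w ≈ₚ a′ s w) → (a ⋆ b) s t ≈ₚ (a′ ⋆ b) s t
  ⋆-congˡ b {s} {t} a≈a′ k = sum-map-cong (interval s t) λ w∈ →
    *ₚ-congˡ (b _ t) (a≈a′ (proj₁ (∈-interval⁻ w∈)) (proj₂ (∈-interval⁻ w∈))) k

  ⋆-diag : ∀ a b s → (a ⋆ b) s s ≈ₚ a s s *ₚ b s s
  ⋆-diag a b s k = sum-map-single (interval-unique s s) (∈-interval⁺ ≤-refl ≤-refl)
    λ w∈ w≢s → ⊥-elim (w≢s (antisym (proj₂ (∈-interval⁻ w∈)) (proj₁ (∈-interval⁻ w∈))))

  ⋆-scalarʳ : ∀ {e b} a → IsScalar P e b → ∀ {s t} → s ≤ t → (a ⋆ b) s t ≈ₚ e ·ₚ a s t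
  ⋆-scalarʳ {e} {b} a (b-diag , b-off) {s} {t} s≤t k = trans
    (sum-map-single (interval-unique s t) (∈-interval⁺ s≤t ≤-refl) vanish)
    (trans (*ₚ-congʳ (a s t) (b-diag t) k) (*ₚ-constₚ e (a s t) k))
    where
    vanish : ∀ {w} → w ∈ interval s t → w ≢ t → (a s w *ₚ b w t) k ≡ + 0
    vanish {w} w∈ w≢t = trans (*ₚ-congʳ (a s w) (≈ₚ-trans (b-off w t (proj₂ (∈-interval⁻ w∈) , w≢t)) constₚ-zero) k)
                              (*ₚ-zeroʳ (a s w) k)

  ⋆-scalarˡ : ∀ {e b} a → IsScalar P e b → ∀ {s t} → s ≤ t → (b ⋆ a) s t ≈ₚ e ·ₚ a s t
  ⋆-scalarˡ {e} {b} a (b-diag , b-off) {s} {t} s≤t k = trans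
    (sum-map-single (interval-unique s t) (∈-interval⁺ ≤-refl s≤t) vanish)
    (trans (*ₚ-congˡ (a s t) (b-diag s) k) (constₚ-*ₚ e (a s t) k))
    where
    vanish : ∀ {w} → w ∈ interval s t → w ≢ s → (b s w *ₚ a w t) k ≡ + 0
    vanish {w} w∈ w≢s = trans (*ₚ-congˡ (a w t) (≈ₚ-trans (b-off s w (proj₁ (∈-interval⁻ w∈) , w≢s ∘ sym)) constₚ-zero) k)
                              (*ₚ-zeroˡ (a w t) k)

  interval-fubini : ∀ s t (F : Carrier → Carrier → ℤ) →
    sumℤ (map (λ w → sumℤ (map (λ v → F v w) (interval s w))) (interval s t)) ≡
    sumℤ (map (λ v → sumℤ (map (λ w → F v w) (interval v t))) (interval s t))
  interval-fubini s t F = begin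
    sumℤ (map (λ w → sumℤ (map (λ v → F v w) (interval s w))) (interval s t))
      ≡⟨ sym (sum-map-pairs (λ (w , v) → F v w) (interval s) (interval s t)) ⟩
    sumℤ (map (λ (w , v) → F v w) lower)
      ≡⟨ cong sumℤ (map-∘ lower) ⟩
    sumℤ (map (λ (v , w) → F v w) (map swap lower))
      ≡⟨ sum-map-set-equal (λ (v , w) → F v w) swapped! upper! (mk⇔ to from) ⟩
    sumℤ (map (λ (v , w) → F v w) upper)
      ≡⟨ sum-map-pairs (λ (v , w) → F v w) (λ v → interval v t) (interval s t) ⟩
    sumℤ (map (λ v → sumℤ (map (λ w → F v w) (interval v t))) (interval s t))
      ∎
    where
    open ≡-Reasoning
    lower = pairs (interval s) (interval s t)
    upper = pairs (λ v → interval v t) (interval s t)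
    swapped! : Unique (map swap lower)
    swapped! = Unique.map⁺ (cong swap) (pairs-unique (interval s t) (interval-unique s t) (interval-unique s))
    upper! : Unique upper
    upper! = pairs-unique (interval s t) (interval-unique s t) (λ v → interval-unique v t)
    to : ∀ {p} → p ∈ map swap lower → p ∈ upper
    to p∈ with (w , v) , wv∈ , refl ← ∈-map⁻ swap p∈ = let w∈ , v∈ = ∈-pairs⁻ (interval s t) wv∈ in
      ∈-pairs⁺ (interval s t) (∈-interval⁺ (proj₁ (∈-interval⁻ v∈)) (≤-trans (proj₂ (∈-interval⁻ v∈)) (proj₂ (∈-interval⁻ w∈))))
                              (∈-interval⁺ (proj₂ (∈-interval⁻ v∈)) (proj₂ (∈-interval⁻ w∈)))
    from : ∀ {p} → p ∈ upper → p ∈ map swap lower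
    from {v , w} p∈ = let v∈ , w∈ = ∈-pairs⁻ (interval s t) p∈ in
      ∈-map⁺ swap (∈-pairs⁺ (interval s t) (∈-interval⁺ (≤-trans (proj₁ (∈-interval⁻ v∈)) (proj₁ (∈-interval⁻ w∈))) (proj₂ (∈-interval⁻ w∈)))
                                           (∈-interval⁺ (proj₁ (∈-interval⁻ v∈)) (proj₁ (∈-interval⁻ w∈))))

  ⋆-assoc : ∀ a b d s t → ((a ⋆ b) ⋆ d) s t ≈ₚ (a ⋆ (b ⋆ d)) s t
  ⋆-assoc a b d s t k = begin
    ((a ⋆ b) ⋆ d) s t k
      ≡⟨ sum-map-cong (interval s t) (λ {w} _ → *ₚ-distribʳ-∑ₚ (interval s w) (λ v → a s v *ₚ b v w) (d w t) k) ⟩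
    sumℤ (map (λ w → sumℤ (map (λ v → ((a s v *ₚ b v w) *ₚ d w t) k) (interval s w))) (interval s t))
      ≡⟨ interval-fubini s t (λ v w → ((a s v *ₚ b v w) *ₚ d w t) k) ⟩
    sumℤ (map (λ v → sumℤ (map (λ w → ((a s v *ₚ b v w) *ₚ d w t) k) (interval v t))) (interval s t))
      ≡⟨ sum-map-cong (interval s t) (λ {v} _ → trans (sum-map-cong (interval v t) (λ {w} _ → *ₚ-assoc (a s v) (b v w) (d w t) k))
                                                      (sym (*ₚ-distribˡ-∑ₚ (interval v t) (λ w → b v w *ₚ d w t) (a s v) k))) ⟩
    (a ⋆ (b ⋆ d)) s t k
      ∎
    where open ≡-Reasoning

  scalar-inverse-unique : ∀ {e g b h} → IsScalar P e (g ⋆ b) → IsScalar P e (b ⋆ h) →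
                          ∀ {s t} → s ≤ t → e ·ₚ g s t ≈ₚ e ·ₚ h s t
  scalar-inverse-unique {e} {g} {b} {h} gb bh {s} {t} s≤t = begin
    e ·ₚ g s t          ≈⟨ ≈ₚ-sym (⋆-scalarʳ g bh s≤t) ⟩
    (g ⋆ (b ⋆ h)) s t   ≈⟨ ≈ₚ-sym (⋆-assoc g b h s t) ⟩
    ((g ⋆ b) ⋆ h) s t   ≈⟨ ⋆-scalarˡ h gb s≤t ⟩
    e ·ₚ h s t          ∎
    where open ≈ₚ-Reasoning

module Ranked {c ℓ} (P : LFPoset c ℓ) (ρ : LFPoset.Carrier P → LFPoset.Carrier P → ℕ) (ρ-rank : IsWeakRank P ρ) where
  open LFPoset P
  open IsPartialOrder isPartialOrder using () renaming (refl to ≤-refl)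
  open IsWeakRank ρ-rank
  open Incidence P

  ρ-refl : ∀ s → ρ s s ≡ 0
  ρ-refl s = sym (ℕₚ.+-cancelˡ-≡ (ρ s s) 0 (ρ s s) (trans (ℕₚ.+-identityʳ (ρ s s)) (add s s s ≤-refl ≤-refl)))

  ρ-<ˡ : ∀ {s w t} → s < w → w ≤ t → ρ w t ℕ.< ρ s t
  ρ-<ˡ {s} {w} {t} s<w w≤t = subst (ρ w t ℕ.<_) (sym (add s w t (proj₁ s<w) w≤t)) (ℕₚ.m<n+m (ρ w t) (pos s w s<w))

  ρ-<ʳ : ∀ {s w t} → s ≤ w → w < t → ρ s w ℕ.< ρ s t
  ρ-<ʳ {s} {w} {t} s≤w w<t = subst (ρ s w ℕ.<_) (sym (add s w t s≤w (proj₁ w<t))) (ℕₚ.m<m+n (ρ s w) (pos w t w<t))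

  rank-rec : ∀ {q} (Q : Carrier → Carrier → Set q) →
             (∀ {s t} → (∀ {u v} → ρ u v ℕ.< ρ s t → Q u v) → Q s t) → ∀ s t → Q s t
  rank-rec {q} Q step s t = <-rec R go (ρ s t) refl
    where
    R : ℕ → Set (c ⊔ q)
    R n = ∀ {s t} → ρ s t ≡ n → Q s t
    go : ∀ n → (∀ {m} → m ℕ.< n → R m) → R n
    go _ ih refl = step λ lt → ih lt refl

  rev-⋆ : ∀ {a b} → InIρ P ρ a → InIρ P ρ b → ∀ {s t} → s ≤ t →
          revAt (ρ s t) ((a ⋆ b) s t) ≈ₚ (rev P ρ a ⋆ rev P ρ b) s t
  rev-⋆ {a} {b} a∈Iρ b∈Iρ {s} {t} s≤t k = trans (revAt-∑ₚ (ρ s t) (interval s t) (λ w → a s w *ₚ b w t) k)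
    (sum-map-cong (interval s t) λ {w} w∈ → let s≤w , w≤t = ∈-interval⁻ w∈ in
      trans (cong (λ d → revAt d (a s w *ₚ b w t) k) (add s w t s≤w w≤t))
            (revAt-*ₚ (ρ s w) (ρ w t) (a s w) (b w t) (a∈Iρ s w s≤w) (b∈Iρ w t w≤t) k))

  eval₁-⋆ : ∀ {a b} → InIρ P ρ a → InIρ P ρ b → ∀ {s t} → s ≤ t →
            eval₁ (ρ s t) ((a ⋆ b) s t) ≡ sumℤ (map (λ w → eval₁ (ρ s w) (a s w) * eval₁ (ρ w t) (b w t)) (interval s t))
  eval₁-⋆ {a} {b} a∈Iρ b∈Iρ {s} {t} s≤t = trans (eval₁-∑ₚ (ρ s t) (interval s t) (λ w → a s w *ₚ b w t))
    (sum-map-cong (interval s t) λ {w} w∈ → let s≤w , w≤t = ∈-interval⁻ w∈ in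
      trans (cong (λ d → eval₁ d (a s w *ₚ b w t)) (add s w t s≤w w≤t))
            (eval₁-*ₚ (ρ s w) (ρ w t) (a s w) (b w t) (a∈Iρ s w s≤w) (b∈Iρ w t w≤t)))

  -- 0 = (f f)_st = 2 f_st + Σ_{s<w<t} f_sw f_wt, and the last sum vanishes by induction on ρ_st.
  unitriangular-involution-trivial : (f : Carrier → Carrier → ℤ) → (∀ s → f s s ≡ + 1) →
    (∀ {s t} → s < t → sumℤ (map (λ w → f s w * f w t) (interval s t)) ≡ + 0) →
    ∀ {s t} → s < t → f s t ≡ + 0
  unitriangular-involution-trivial f f-diag f²≡δ {s} {t} = rank-rec (λ s t → s < t → f s t ≡ + 0) step s t
    where
    step : ∀ {s t} → (∀ {u v} → ρ u v ℕ.< ρ s t → u < v → f u v ≡ + 0) → s < t → f s t ≡ + 0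
    step {s} {t} ih s<t@(s≤t , s≢t) = double≡0 (begin
      f s t + f s t                    ≡⟨ sym (cong₂ _+_ (trans (cong (_* f s t) (f-diag s)) (ℤₚ.*-identityˡ (f s t)))
                                                         (trans (cong (f s t *_) (f-diag t)) (ℤₚ.*-identityʳ (f s t)))) ⟩
      f s s * f s t + f s t * f t t    ≡⟨ sym (sum-map-pair (interval-unique s t) (∈-interval⁺ ≤-refl s≤t) (∈-interval⁺ s≤t ≤-refl)
                                                            (s≢t ∘ sym) middle) ⟩
      sumℤ (map (λ w → f s w * f w t) (interval s t))  ≡⟨ f²≡δ s<t ⟩
      + 0                              ∎)
      where
      open ≡-Reasoning
      middle : ∀ {w} → w ∈ interval s t → w ≢ s → w ≢ t → f s w * f w t ≡ + 0
      middle {w} w∈ w≢s w≢t = let s≤w , w≤t = ∈-interval⁻ w∈ in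
        trans (cong (_* f w t) (ih (ρ-<ʳ s≤w (w≤t , w≢t)) (s≤w , w≢s ∘ sym))) (ℤₚ.*-zeroˡ (f w t))
      double≡0 : ∀ {x} → x + x ≡ + 0 → x ≡ + 0
      double≡0 {+ 0}      _  = refl
      double≡0 {+ suc _}  ()
      double≡0 {ℤ.-[1+ _ ]} ()

-- Kernels, reduced kernels and Chow functions

module Kernel {c ℓ} (P : LFPoset c ℓ) (ρ : LFPoset.Carrier P → LFPoset.Carrier P → ℕ) (ρ-rank : IsWeakRank P ρ)
              (κ : Inc P) (kernel : IsKernel P ρ κ) where
  open LFPoset P
  open IsPartialOrder isPartialOrder using () renaming (refl to ≤-refl)
  open IsWeakRank ρ-rank
  open IsKernel kernel
  open Incidence P
  open Ranked P ρ ρ-rank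

  kernel-eval₁≡0 : ∀ {s t} → s < t → eval₁ (ρ s t) (κ s t) ≡ + 0
  kernel-eval₁≡0 = unitriangular-involution-trivial κ[1] κ[1]-diag κ[1]²≡δ
    where
    κ[1] : Carrier → Carrier → ℤ
    κ[1] s t = eval₁ (ρ s t) (κ s t)
    κ[1]-diag : ∀ s → κ[1] s s ≡ + 1
    κ[1]-diag s = trans (cong (λ d → eval₁ d (κ s s)) (ρ-refl s)) (diag s 0)
    κ[1]²≡δ : ∀ {s t} → s < t → sumℤ (map (λ w → κ[1] s w * κ[1] w t) (interval s t)) ≡ + 0
    κ[1]²≡δ {s} {t} s<t = begin
      sumℤ (map (λ w → κ[1] s w * κ[1] w t) (interval s t))
        ≡⟨ sum-map-cong (interval s t) (λ {w} _ → cong (_* κ[1] w t) (sym (eval₁-revAt (ρ s w) (κ s w)))) ⟩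
      sumℤ (map (λ w → eval₁ (ρ s w) (rev P ρ κ s w) * κ[1] w t) (interval s t))
        ≡⟨ sym (eval₁-⋆ (λ s t _ → revAt-DegLe (ρ s t) (κ s t)) inIρ (proj₁ s<t)) ⟩
      eval₁ (ρ s t) ((rev P ρ κ ⋆ κ) s t)
        ≡⟨ eval₁-cong (ρ s t) (≈ₚ-trans (proj₂ rev-inv s t s<t) constₚ-zero) ⟩
      eval₁ (ρ s t) 0ₚ
        ≡⟨ eval₁-0ₚ (ρ s t) ⟩
      + 0
        ∎
      where open ≡-Reasoning

  module Reduced (κ̄ : Inc P) (reduced : IsReducedKernel P κ κ̄) where

    reduced-DegLe : ∀ {s t} → s < t → DegLe (κ̄ s t) (ρ s t ∸ 1)
    reduced-DegLe {s} {t} s<t =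
      x-1-quotient-DegLe (ρ s t) (proj₂ reduced s t s<t) (inIρ s t (proj₁ s<t)) (kernel-eval₁≡0 s<t)

    ⋆κ-decomposition : ∀ A {s t} → s < t → (A ⋆ κ) s t ≈ₚ x-1 *ₚ (A ⋆ κ̄) s t +ₚ X *ₚ A s t
    ⋆κ-decomposition A {s} {t} (s≤t , _) k = begin
      (A ⋆ κ) s t k                                    ≡⟨ sub-add ((A ⋆ κ) s t k) y ⟩
      ((A ⋆ κ) s t k + - y) + y                        ≡⟨ cong (λ z → ((A ⋆ κ) s t k + z) + y) (sym at-t) ⟩
      ((A ⋆ κ) s t k + g t) + y                        ≡⟨ cong (_+ y) (sum-map-except (interval-unique s t) (∈-interval⁺ s≤t ≤-refl) off-t) ⟩
      (sumℤ (map g (interval s t)) + f t) + y          ≡⟨ cong₂ (λ u v → (u + v) + y) Σg (trans (*ₚ-congʳ (A s t) (diag t) k) (*ₚ-identityʳ (A s t) k)) ⟩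
      ((x-1 *ₚ (A ⋆ κ̄) s t) k + A s t k) + y          ≡⟨ ℤₚ.+-assoc ((x-1 *ₚ (A ⋆ κ̄) s t) k) (A s t k) y ⟩
      (x-1 *ₚ (A ⋆ κ̄) s t) k + (A s t k + y)          ≡⟨ cong (_+_ ((x-1 *ₚ (A ⋆ κ̄) s t) k)) (sym (X*ₚ≈+ₚx-1*ₚ (A s t) k)) ⟩
      (x-1 *ₚ (A ⋆ κ̄) s t +ₚ X *ₚ A s t) k            ∎
      where
      open ≡-Reasoning
      f g : Carrier → ℤ
      f w = (A s w *ₚ κ w t) k
      g w = (x-1 *ₚ (A s w *ₚ κ̄ w t)) k
      y = (x-1 *ₚ A s t) k
      sub-add : ∀ a b → a ≡ (a + - b) + b
      sub-add = solve-∀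
      off-t : ∀ {w} → w ∈ interval s t → w ≢ t → f w ≡ g w
      off-t {w} w∈ w≢t = trans (*ₚ-congʳ (A s w) (≈ₚ-sym (proj₂ reduced w t (proj₂ (∈-interval⁻ w∈) , w≢t))) k)
                               (*ₚ-left-comm (A s w) x-1 (κ̄ w t) k)
      at-t : g t ≡ - y
      at-t = begin
        (x-1 *ₚ (A s t *ₚ κ̄ t t)) k                ≡⟨ *ₚ-congʳ x-1 (≈ₚ-trans (*ₚ-congʳ (A s t) (proj₁ reduced t)) (*ₚ-constₚ _ (A s t))) k ⟩
        (x-1 *ₚ (- (+ 1) ·ₚ A s t)) k              ≡⟨ *ₚ-·ₚ (- (+ 1)) x-1 (A s t) k ⟩
        - (+ 1) * y                                ≡⟨ ℤₚ.-1*i≡-i y ⟩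
        - y                                        ∎
      Σg : sumℤ (map g (interval s t)) ≡ (x-1 *ₚ (A ⋆ κ̄) s t) k
      Σg = sym (*ₚ-distribˡ-∑ₚ (interval s t) (λ w → A s w *ₚ κ̄ w t) x-1 k)

    ⋆κ≈X*ₚ : ∀ A {s t} → s < t → (A ⋆ κ̄) s t ≈ₚ 0ₚ → (A ⋆ κ) s t ≈ₚ X *ₚ A s t
    ⋆κ≈X*ₚ A {s} {t} s<t Aκ̄≈0 = begin
      (A ⋆ κ) s t                          ≈⟨ ⋆κ-decomposition A s<t ⟩
      x-1 *ₚ (A ⋆ κ̄) s t +ₚ X *ₚ A s t     ≈⟨ +ₚ-cong (≈ₚ-trans (*ₚ-congʳ x-1 Aκ̄≈0) (*ₚ-zeroʳ x-1)) ≈ₚ-refl ⟩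
      0ₚ +ₚ X *ₚ A s t                     ≈⟨ (λ k → ℤₚ.+-identityˡ ((X *ₚ A s t) k)) ⟩
      X *ₚ A s t                           ∎
      where open ≈ₚ-Reasoning

    ⋆κ̄≈0ₚ : ∀ A {s t} → s < t → (A ⋆ κ) s t ≈ₚ X *ₚ A s t → (A ⋆ κ̄) s t ≈ₚ 0ₚ
    ⋆κ̄≈0ₚ A {s} {t} s<t Aκ≈XA = x-1*ₚ-cancel λ k → trans
      (+-identityˡ-unique ((x-1 *ₚ (A ⋆ κ̄) s t) k) ((X *ₚ A s t) k) (trans (sym (⋆κ-decomposition A s<t k)) (Aκ≈XA k)))
      (sym (*ₚ-zeroʳ x-1 k))

    module Chow (H : Inc P) (chow : IsChowFunction P κ̄ H) where

      chow-diag : ∀ s → H s s ≈ₚ 1ₚ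
      chow-diag s = -1·ₚ-cancel (begin
        - (+ 1) ·ₚ H s s               ≈⟨ ≈ₚ-sym (constₚ-*ₚ (- (+ 1)) (H s s)) ⟩
        constₚ (- (+ 1)) *ₚ H s s      ≈⟨ *ₚ-congˡ (H s s) (≈ₚ-sym (proj₁ reduced s)) ⟩
        κ̄ s s *ₚ H s s                 ≈⟨ ≈ₚ-sym (⋆-diag κ̄ H s) ⟩
        (κ̄ ⋆ H) s s                    ≈⟨ proj₁ (proj₁ chow) s ⟩
        constₚ (- (+ 1))               ≈⟨ constₚ≈·ₚ1ₚ (- (+ 1)) ⟩
        - (+ 1) ·ₚ 1ₚ                  ∎)
        where open ≈ₚ-Reasoning

      -- Off the diagonal 0 = (κ̄ H)_st = -H_st + Σ_{s<w≤t} κ̄_sw H_wt, and by induction on ρ_st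
      -- every term of the sum has degree below ρ_st - 1.
      chow-DegLe : ∀ {s t} → s ≤ t → DegLe (H s t) (ρ s t ∸ 1)
      chow-DegLe {s} {t} = rank-rec (λ s t → s ≤ t → DegLe (H s t) (ρ s t ∸ 1)) step s t
        where
        step : ∀ {s t} → (∀ {u v} → ρ u v ℕ.< ρ s t → u ≤ v → DegLe (H u v) (ρ u v ∸ 1)) →
               s ≤ t → DegLe (H s t) (ρ s t ∸ 1)
        step {s} {t} ih s≤t k = ≤-elim (λ s t → ρ s t ∸ 1 ℕ.< k → H s t k ≡ + 0)
          ((ρ s t ∸ 1 ℕₚ.<? k) →-dec (H s t k ℤ.≟ + 0))
          (λ u d<k → trans (chow-diag u k) (DegLe-constₚ (+ 1) (ρ u u ∸ 1) k d<k))
          off s≤t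
          where
          off : s < t → ρ s t ∸ 1 ℕ.< k → H s t k ≡ + 0
          off s<t d<k = ℤₚ.neg-injective (begin
            - H s t k                    ≡⟨ sym (ℤₚ.-1*i≡-i (H s t k)) ⟩
            (- (+ 1) ·ₚ H s t) k         ≡⟨ sym (constₚ-*ₚ (- (+ 1)) (H s t) k) ⟩
            (constₚ (- (+ 1)) *ₚ H s t) k ≡⟨ *ₚ-congˡ (H s t) (≈ₚ-sym (proj₁ reduced s)) k ⟩
            (κ̄ s s *ₚ H s t) k           ≡⟨ sym (sum-map-single (interval-unique s t) (∈-interval⁺ ≤-refl s≤t) higher) ⟩
            (κ̄ ⋆ H) s t k                ≡⟨ proj₂ (proj₁ chow) s t s<t k ⟩
            constₚ (+ 0) k               ≡⟨ constₚ-zero k ⟩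
            + 0                          ∎)
            where
            open ≡-Reasoning
            higher : ∀ {w} → w ∈ interval s t → w ≢ s → (κ̄ s w *ₚ H w t) k ≡ + 0
            higher {w} w∈ w≢s = *ₚ-DegLe (ρ s w ∸ 1) (ρ w t ∸ 1) (reduced-DegLe s<w) (ih (ρ-<ˡ s<w w≤t) w≤t) k
              (ℕₚ.≤-<-trans (ℕₚ.≤-trans (∸1+∸1≤∸1 (ρ w t) (pos s w s<w)) (ℕₚ.≤-reflexive (cong (_∸ 1) (sym (add s w t s≤w w≤t))))) d<k)
              where
              s≤w = proj₁ (∈-interval⁻ w∈)
              w≤t = proj₂ (∈-interval⁻ w∈)
              s<w = s≤w , w≢s ∘ sym

      chow∈Iρ : InIρ P ρ H
      chow∈Iρ s t s≤t = DegLe-mono (chow-DegLe s≤t) (ℕₚ.m∸n≤m (ρ s t) 1)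

      chow⋆κ : ∀ {s t} → s < t → (H ⋆ κ) s t ≈ₚ X *ₚ H s t
      chow⋆κ {s} {t} s<t = ⋆κ≈X*ₚ H s<t (≈ₚ-trans (proj₂ (proj₂ chow) s t s<t) constₚ-zero)

      chow-top-coeff : ∀ {s t} → s < t → H s t (ρ s t ∸ 1) ≡ κ s t (ρ s t)
      chow-top-coeff {s} {t} s<t@(s≤t , _) = begin
        H s t (ρ s t ∸ 1)               ≡⟨ sym (X*ₚ-coeffSuc (H s t) (ρ s t ∸ 1)) ⟩
        (X *ₚ H s t) (suc (ρ s t ∸ 1))  ≡⟨ cong (X *ₚ H s t) (suc-∸1 (pos s t s<t)) ⟩
        (X *ₚ H s t) (ρ s t)            ≡⟨ sym (chow⋆κ s<t (ρ s t)) ⟩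
        (H ⋆ κ) s t (ρ s t)             ≡⟨ sum-map-single (interval-unique s t) (∈-interval⁺ ≤-refl s≤t) higher ⟩
        (H s s *ₚ κ s t) (ρ s t)        ≡⟨ trans (*ₚ-congˡ (κ s t) (chow-diag s) (ρ s t)) (*ₚ-identityˡ (κ s t) (ρ s t)) ⟩
        κ s t (ρ s t)                   ∎
        where
        open ≡-Reasoning
        higher : ∀ {w} → w ∈ interval s t → w ≢ s → (H s w *ₚ κ w t) (ρ s t) ≡ + 0
        higher {w} w∈ w≢s = *ₚ-DegLe (ρ s w ∸ 1) (ρ w t) (chow-DegLe s≤w) (inIρ w t w≤t) (ρ s t)
          (subst (ρ s w ∸ 1 ℕ.+ ρ w t ℕ.<_) (sym (add s w t s≤w w≤t)) (∸1+<+ (ρ w t) (pos s w (s≤w , w≢s ∘ sym))))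
          where
          s≤w = proj₁ (∈-interval⁻ w∈)
          w≤t = proj₂ (∈-interval⁻ w∈)

      chow-HasDegree : ∀ {s t} → s < t → HasDegree (κ s t) (ρ s t) → HasDegree (H s t) (ρ s t ∸ 1)
      chow-HasDegree s<t (κ-top≢0 , _) = (λ H-top≡0 → κ-top≢0 (trans (sym (chow-top-coeff s<t)) H-top≡0)) ,
                                          chow-DegLe (proj₁ s<t)

      reversedChow : Inc P
      reversedChow s t = revAt (ρ s t ∸ 1) (H s t)

      reversedChow≈rev⋆rev : ∀ {s t} → s ≤ t → reversedChow s t ≈ₚ (rev P ρ H ⋆ rev P ρ κ) s t
      reversedChow≈rev⋆rev {s} {t} s≤t k = ≤-elim (λ s t → reversedChow s t k ≡ (rev P ρ H ⋆ rev P ρ κ) s t k)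
        (reversedChow s t k ℤ.≟ (rev P ρ H ⋆ rev P ρ κ) s t k) on-diag off s≤t
        where
        on-diag : ∀ u → reversedChow u u k ≡ (rev P ρ H ⋆ rev P ρ κ) u u k
        on-diag u = trans (revAt-≈1ₚ (cong (_∸ 1) (ρ-refl u)) (chow-diag u) k) (sym (begin
          (rev P ρ H ⋆ rev P ρ κ) u u k       ≡⟨ ⋆-diag (rev P ρ H) (rev P ρ κ) u k ⟩
          (rev P ρ H u u *ₚ rev P ρ κ u u) k  ≡⟨ *ₚ-congˡ (rev P ρ κ u u) (revAt-≈1ₚ (ρ-refl u) (chow-diag u)) k ⟩
          (1ₚ *ₚ rev P ρ κ u u) k             ≡⟨ *ₚ-identityˡ (rev P ρ κ u u) k ⟩
          rev P ρ κ u u k                     ≡⟨ revAt-≈1ₚ (ρ-refl u) (diag u) k ⟩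
          1ₚ k                                ∎))
          where open ≡-Reasoning
        off : s < t → reversedChow s t k ≡ (rev P ρ H ⋆ rev P ρ κ) s t k
        off s<t = begin
          revAt (ρ s t ∸ 1) (H s t) k              ≡⟨ sym (revAt-X*ₚ (ρ s t ∸ 1) (H s t) k) ⟩
          revAt (suc (ρ s t ∸ 1)) (X *ₚ H s t) k   ≡⟨ cong (λ d → revAt d (X *ₚ H s t) k) (suc-∸1 (pos s t s<t)) ⟩
          revAt (ρ s t) (X *ₚ H s t) k             ≡⟨ revAt-cong (ρ s t) (≈ₚ-sym (chow⋆κ s<t)) k ⟩
          revAt (ρ s t) ((H ⋆ κ) s t) k            ≡⟨ rev-⋆ chow∈Iρ inIρ s≤t k ⟩
          (rev P ρ H ⋆ rev P ρ κ) s t k            ∎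
          where open ≡-Reasoning

      reversedChow⋆κ : ∀ {s t} → s < t → (reversedChow ⋆ κ) s t ≈ₚ X *ₚ reversedChow s t
      reversedChow⋆κ {s} {t} s<t@(s≤t , _) = begin
        (reversedChow ⋆ κ) s t
          ≈⟨ ⋆-congˡ {reversedChow} {rev P ρ H ⋆ rev P ρ κ} κ (λ s≤w _ → reversedChow≈rev⋆rev s≤w) ⟩
        ((rev P ρ H ⋆ rev P ρ κ) ⋆ κ) s t
          ≈⟨ ⋆-assoc (rev P ρ H) (rev P ρ κ) κ s t ⟩
        (rev P ρ H ⋆ (rev P ρ κ ⋆ κ)) s t
          ≈⟨ ⋆-scalarʳ (rev P ρ H) rev-inv s≤t ⟩
        + 1 ·ₚ revAt (ρ s t) (H s t)
          ≈⟨ (λ k → ℤₚ.*-identityˡ (revAt (ρ s t) (H s t) k)) ⟩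
        revAt (ρ s t) (H s t)
          ≈⟨ (λ k → cong (λ d → revAt d (H s t) k) (sym (suc-∸1 (pos s t s<t)))) ⟩
        revAt (suc (ρ s t ∸ 1)) (H s t)
          ≈⟨ revAt-suc (ρ s t ∸ 1) (H s t) (chow-DegLe s≤t) ⟩
        X *ₚ reversedChow s t
          ∎
        where open ≈ₚ-Reasoning

      reversedChow⋆κ̄≈-δ : IsScalar P (- (+ 1)) (reversedChow ⋆ κ̄)
      reversedChow⋆κ̄≈-δ = on-diag , λ s t s<t → ≈ₚ-trans (⋆κ̄≈0ₚ reversedChow s<t (reversedChow⋆κ s<t)) (≈ₚ-sym constₚ-zero)
        where
        on-diag : ∀ s → (reversedChow ⋆ κ̄) s s ≈ₚ constₚ (- (+ 1))
        on-diag s = begin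
          (reversedChow ⋆ κ̄) s s     ≈⟨ ⋆-diag reversedChow κ̄ s ⟩
          reversedChow s s *ₚ κ̄ s s  ≈⟨ *ₚ-congˡ (κ̄ s s) (revAt-≈1ₚ (cong (_∸ 1) (ρ-refl s)) (chow-diag s)) ⟩
          1ₚ *ₚ κ̄ s s                ≈⟨ *ₚ-identityˡ (κ̄ s s) ⟩
          κ̄ s s                      ≈⟨ proj₁ reduced s ⟩
          constₚ (- (+ 1))           ∎
          where open ≈ₚ-Reasoning

      reversedChow≈chow : ∀ {s t} → s ≤ t → reversedChow s t ≈ₚ H s t
      reversedChow≈chow s≤t = -1·ₚ-cancel (scalar-inverse-unique {g = reversedChow} {κ̄} {H} reversedChow⋆κ̄≈-δ (proj₁ chow) s≤t)

proposition3p4 : {c ℓ : Level} (P : LFPoset c ℓ) (ρ : LFPoset.Carrier P → LFPoset.Carrier P → ℕ)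
    → IsWeakRank P ρ
    → (κ κ̄ H : Inc P)
    → IsKernel P ρ κ
    → IsReducedKernel P κ κ̄
    → IsChowFunction P κ̄ H
    → ((∀ s t → LFPoset._<_ P s t → H s t (ρ s t ∸ 1) ≡ κ s t (ρ s t))
       × (NonDegenerate P ρ κ → ∀ s t → LFPoset._<_ P s t → HasDegree (H s t) (ρ s t ∸ 1)))
      × (∀ s t → LFPoset._<_ P s t → H s t ≈ₚ revAt (ρ s t ∸ 1) (H s t))
proposition3p4 P ρ ρ-rank κ κ̄ H kernel reduced chow =
  ( (λ _ _ → chow-top-coeff)
  , (λ nondeg s t s<t → chow-HasDegree s<t (nondeg s t (proj₁ s<t))) )
  , (λ _ _ s<t → ≈ₚ-sym (reversedChow≈chow (proj₁ s<t)))
  where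
  open Kernel P ρ ρ-rank κ kernel
  open Reduced κ̄ reduced
  open Chow H chow
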